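{- For every finite simple graph $G$ the following are equivalent: (i) $G$ is a proper $2$-color-line graph; (ii) $G$ admits a clique partition $V(G)=A\cup B$ (with $A,B$ disjoint cliques) such that each vertex in $A$ has at most two neighbors in $B$ and each vertex in $B$ has at most two neighbors in $A$; (iii) $G\cong\mathrm{CL}(H)$ for some bipartite graph $H$ with a proper edge $2$-coloring, in which each component of $H$ is a path or an even cycle.
   Context: An edge $2$-coloring of a graph $H$ is a map $\phi:E(H)\to\{1,2\}$; it is proper if any two distinct edges sharing an endvertex get different colors. For an edge-colored graph $(H,\phi)$, the color-line graph $\mathrm{CL}(H)$ has vertex set $E(H)$, two distinct vertices being adjacent iff the corresponding edges of $H$ share an endvertex or have the same color. $G$ is a proper $2$-color-line graph if $G\cong\mathrm{CL}(H)$ for some graph $H$ with a proper edge $2$-coloring. A clique is a set of pairwise adjacent vertices. -}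

module Defs where

open import Data.Nat using (ℕ; zero; suc; _≥_; _%_)
open import Data.Nat.Divisibility using (_∣_)
open import Data.Bool using (Bool; true; false)
open import Data.Fin using (Fin; toℕ; _<_)
open import Data.Fin.Subset using (Subset; _∈_)
open import Data.Product using (Σ; Σ-syntax; ∃; ∃-syntax; _×_; _,_; proj₁; proj₂)
open import Data.Sum using (_⊎_)
open import Data.Empty using (⊥)
open import Relation.Nullary using (¬_)
open import Relation.Binary.PropositionalEquality using (_≡_; _≢_)
open import Relation.Binary.Construct.Closure.ReflexiveTransitive using (Star)
open import Function.Bundles using (_⤖_; _⇔_; Bijection)

record FinGraph (n : ℕ) : Set where
  field
    adj    : Fin n → Fin n → Bool
    sym    : ∀ x y → adj x y ≡ adj y x
    irrefl : ∀ x → adj x x ≡ false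

open FinGraph public

Adj : ∀ {n} → FinGraph n → Fin n → Fin n → Set
Adj G x y = adj G x y ≡ true

IsoTo : (k : ℕ) (AdjK : Fin k → Fin k → Set)
        (V : Set) (AdjV : V → V → Set) → Set
IsoTo k AdjK V AdjV =
  Σ[ f ∈ Fin k ⤖ V ]
    (∀ i j → AdjK i j ⇔ AdjV (Bijection.to f i) (Bijection.to f j))

-- Edges of H: unordered pairs {u,v} represented as u < v with u ~ v.

Edge : ∀ {m} → FinGraph m → Set
Edge {m} H = Σ[ u ∈ Fin m ] Σ[ v ∈ Fin m ] (u < v × Adj H u v)

src tgt : ∀ {m} {H : FinGraph m} → Edge H → Fin m
src e = proj₁ e
tgt e = proj₁ (proj₂ e)

ShareEnd : ∀ {m} {H : FinGraph m} → Edge H → Edge H → Set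
ShareEnd {H = H} e f =
  (src {H = H} e ≡ src {H = H} f) ⊎ (src {H = H} e ≡ tgt {H = H} f)
  ⊎ (tgt {H = H} e ≡ src {H = H} f) ⊎ (tgt {H = H} e ≡ tgt {H = H} f)

EdgeColouring : ∀ {m} → FinGraph m → Set
EdgeColouring H = Edge H → Fin 2

Proper : ∀ {m} {H : FinGraph m} → EdgeColouring H → Set
Proper {H = H} φ = ∀ e f → e ≢ f → ShareEnd {H = H} e f → φ e ≢ φ f

CLAdj : ∀ {m} {H : FinGraph m} → EdgeColouring H → Edge H → Edge H → Set
CLAdj {H = H} φ e f = e ≢ f × (ShareEnd {H = H} e f ⊎ φ e ≡ φ f)

IsoCL : ∀ {n m} → FinGraph n → (H : FinGraph m) → EdgeColouring H → Set
IsoCL {n} G H φ = IsoTo n (Adj G) (Edge H) (CLAdj {H = H} φ)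

IsProper2ColourLine : ∀ {n} → FinGraph n → Set
IsProper2ColourLine G =
  ∃[ m ] Σ[ H ∈ FinGraph m ] Σ[ φ ∈ EdgeColouring H ] (Proper {H = H} φ × IsoCL G H φ)

IsClique : ∀ {n} → FinGraph n → Subset n → Set
IsClique G A = ∀ x y → x ∈ A → y ∈ A → x ≢ y → Adj G x y

AtMostTwoNbrsIn : ∀ {n} → FinGraph n → Fin n → Subset n → Set
AtMostTwoNbrsIn G x B =
  ∀ y₁ y₂ y₃ → y₁ ∈ B → y₂ ∈ B → y₃ ∈ B →
  y₁ ≢ y₂ → y₁ ≢ y₃ → y₂ ≢ y₃ →
  ¬ (Adj G x y₁ × Adj G x y₂ × Adj G x y₃)

HasGoodCliquePartition : ∀ {n} → FinGraph n → Set
HasGoodCliquePartition {n} G =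
  Σ[ A ∈ Subset n ] Σ[ B ∈ Subset n ]
    ((∀ x → x ∈ A ⊎ x ∈ B) × (∀ x → ¬ (x ∈ A × x ∈ B)) ×
     IsClique G A × IsClique G B ×
     (∀ x → x ∈ A → AtMostTwoNbrsIn G x B) ×
     (∀ x → x ∈ B → AtMostTwoNbrsIn G x A))

IsBipartite : ∀ {m} → FinGraph m → Set
IsBipartite {m} H = Σ[ side ∈ (Fin m → Bool) ] (∀ u v → Adj H u v → side u ≢ side v)

Reach : ∀ {m} → FinGraph m → Fin m → Fin m → Set
Reach H = Star (Adj H)

PathAdj : (k : ℕ) → Fin k → Fin k → Set
PathAdj k i j = (suc (toℕ i) ≡ toℕ j) ⊎ (suc (toℕ j) ≡ toℕ i)

CycleAdj : (k : ℕ) → Fin k → Fin k → Set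
CycleAdj zero i j = ⊥   -- vacuous (Fin 0 is empty)
CycleAdj (suc k') i j =
  (toℕ j ≡ suc (toℕ i) % suc k') ⊎ (toℕ i ≡ suc (toℕ j) % suc k')

InducedVerts : ∀ {m} → Subset m → Set
InducedVerts {m} C = Σ[ u ∈ Fin m ] u ∈ C

InducedAdj : ∀ {m} (H : FinGraph m) (C : Subset m) →
             InducedVerts C → InducedVerts C → Set
InducedAdj H C u v = Adj H (proj₁ u) (proj₁ v)

IsPathOrEvenCycle : ∀ {m} (H : FinGraph m) (C : Subset m) → Set
IsPathOrEvenCycle H C =
  (∃[ k ] IsoTo k (PathAdj k) (InducedVerts C) (InducedAdj H C))
  ⊎ (∃[ k ] (k ≥ 3 × 2 ∣ k × IsoTo k (CycleAdj k) (InducedVerts C) (InducedAdj H C)))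

ComponentsPathsOrEvenCycles : ∀ {m} → FinGraph m → Set
ComponentsPathsOrEvenCycles {m} H =
  ∀ (v : Fin m) (C : Subset m) → (∀ u → (u ∈ C) ⇔ Reach H v u) →
  IsPathOrEvenCycle H C

IsBipartitePathCycleCL : ∀ {n} → FinGraph n → Set
IsBipartitePathCycleCL G =
  ∃[ m ] Σ[ H ∈ FinGraph m ] Σ[ φ ∈ EdgeColouring H ]
    (IsBipartite H × ComponentsPathsOrEvenCycles H × Proper {H = H} φ × IsoCL G H φ)

-- (i) ⇒ (ii): colour each vertex of G by the colour of its edge in H. Equal colours make a colour
-- class a clique, and since the colouring is proper an edge of H meets, at each of its two ends, at
-- most one edge of the other colour, so a vertex has at most two neighbours across.
-- (ii) ⇒ (iii): the edges between A and B form a graph of maximum degree two, hence a disjoint union of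
-- paths and cycles, the cycles even because they alternate between A and B. It is built vertex by
-- vertex: a new vertex has at most two earlier neighbours across, each the end of a path, so it starts,
-- extends or joins paths, or closes a path into a cycle. A path with ℓ vertices is the line graph of a
-- path with ℓ + 1 vertices and a cycle the line graph of itself; the disjoint union H of these, each
-- edge coloured by the side of its vertex, has CL(H) ≅ G, the cliques A and B supplying the edges of
-- equal colour. (iii) ⇒ (i) is immediate.

module Submission where

open import Defs hiding (sym)
open import Data.Nat using (ℕ; zero; suc; _+_; _*_; _≤_; _<_; s≤s; z≤n; _≟_; _<?_; NonZero)
open import Data.Nat.Properties
  using (suc-injective; <-irrelevant; <-irrefl; <-asym; ≤-refl; ≤-reflexive; ≤-trans; ≤-pred; <⇒≤;
         n≤1+n; 1+n≰n; n≮0; m≤n⇒m<n∨m≡n; +-monoʳ-<; +-cancelˡ-<)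
open import Data.Nat.Divisibility using (_∣_; divides)
open import Data.Nat.DivMod using (_%_; m<n⇒m%n≡m; n%n≡0)
open import Data.Bool using (Bool; true; false; not; _xor_)
open import Data.Bool.Properties using (not-involutive; not-¬; ¬-not) renaming (_≟_ to _≟ᵇ_)
import Data.Fin as Fin
open import Data.Fin using (Fin; toℕ; fromℕ; fromℕ<; inject₁; _↑ˡ_; _↑ʳ_; splitAt)
  renaming (zero to fzero; suc to fsuc)
open import Data.Fin.Properties
  using (toℕ-injective; toℕ-fromℕ; toℕ-fromℕ<; toℕ-inject₁; toℕ<n; toℕ≤pred[n];
         splitAt-↑ˡ; splitAt-↑ʳ; splitAt⁻¹-↑ˡ; splitAt⁻¹-↑ʳ; toℕ-↑ˡ; toℕ-↑ʳ;
         ↑ˡ-injective; ↑ʳ-injective)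
open import Data.Fin.Subset using (Subset) renaming (_∈_ to _∈ₛ_)
import Data.Vec as Vec
open import Data.Vec.Properties using ([]=⇒lookup; lookup⇒[]=; lookup∘tabulate)
open import Data.Vec.Properties.WithK using ([]=-irrelevant)
open import Data.List using (List; []; _∷_; _++_; _∷ʳ_; [_]; length; lookup; reverse; filter; allFin)
open import Data.List.Properties using (unfold-reverse; reverse-++; reverse-involutive; ++-assoc)
open import Data.List.Membership.Propositional using (_∈_; lose)
open import Data.List.Membership.Propositional.Properties
  using (∈-∃++; ∈-++⁺ˡ; ∈-++⁺ʳ; ∈-++⁻; ∈-lookup; ∈-filter⁺; ∈-filter⁻; ∈-allFin)
open import Data.List.Relation.Unary.Any using (Any; here; there; index; toSum; fromSum)
open import Data.List.Relation.Unary.Any.Properties using (lookup-index)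
import Data.List.Relation.Unary.All as All
open import Data.List.Relation.Unary.All using ([]; _∷_)
open import Data.List.Relation.Unary.AllPairs using ([]; _∷_)
open import Data.List.Relation.Unary.Unique.Propositional using (Unique)
import Data.List.Relation.Unary.Unique.Propositional.Properties as Unique
open import Data.List.Relation.Binary.Permutation.Propositional
  using (_↭_; ↭-refl; ↭-sym; ↭-trans; ↭-prep; module PermutationReasoning)
  renaming (refl to ↭-≡; prep to ↭-∷; swap to ↭-swap; trans to ↭-∘)
open import Data.List.Relation.Binary.Permutation.Propositional.Properties
  using (All-resp-↭; Any-resp-↭; ∈-resp-↭; ++⁺ˡ; ++⁺ʳ; shift; shifts; ↭-reverse)
open import Data.Product using (Σ; ∃; ∃₂; _×_; _,_; proj₁; proj₂)
import Data.Sum as Sum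
open import Data.Sum using (_⊎_; inj₁; inj₂; map₁)
open import Data.Sum.Properties using (inj₁-injective; inj₂-injective)
open import Data.Sum.Function.Propositional using (_⊎-↔_)
open import Data.Empty using (⊥; ⊥-elim)
open import Relation.Nullary using (¬_; Dec; yes; no)
open import Relation.Nullary.Decidable using (isYes; _×-dec_; _⊎-dec_; ¬?)
open import Relation.Binary.PropositionalEquality
  using (_≡_; _≢_; refl; sym; trans; cong; cong₂; subst; subst₂; ≢-sym)
open import Axiom.UniquenessOfIdentityProofs.WithK using (uip)
open import Relation.Binary.Construct.Closure.ReflexiveTransitive using (ε; _◅_; _◅◅_)
import Relation.Binary.Construct.Closure.ReflexiveTransitive as Star
open import Function using (id; _∘_; _∘′_; case_of_)
open import Function.Bundles
  using (_⤖_; _⇔_; _↔_; Bijection; Inverse; Equivalence; mk⇔; mk⤖; mk↔ₛ′)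
open import Function.Construct.Composition using (_↔-∘_; _⤖-∘_)
open import Function.Properties.Inverse using (↔⇒⤖)

-- Consecutive entries of lists

module _ {A : Set} where

  data Consecutive : List A → A → A → Set where
    here  : ∀ {x y xs} → Consecutive (x ∷ y ∷ xs) x y
    there : ∀ {z xs x y} → Consecutive xs x y → Consecutive (z ∷ xs) x y

  data Last : List A → A → Set where
    here  : ∀ {x} → Last [ x ] x
    there : ∀ {z xs x} → Last xs x → Last (z ∷ xs) x

  Head : List A → A → Set
  Head xs x = ∃ λ ys → xs ≡ x ∷ ys

  Neighbours : List A → A → A → Set
  Neighbours xs x y = Consecutive xs x y ⊎ Consecutive xs y x

  CyclicNeighbours : List A → A → A → Set
  CyclicNeighbours xs x y =
    Neighbours xs x y ⊎ (Last xs x × Head xs y) ⊎ (Last xs y × Head xs x)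

  JoinedTo : A → (A → Set) → A → A → Set
  JoinedTo z E a w = (a ≡ z × E w) ⊎ (w ≡ z × E a)

  Ends : List A → List A → A → Set
  Ends xs ys y = Last xs y ⊎ Head ys y

  JoinedTo-map : ∀ {z a w} {E F : A → Set} → (∀ {y} → E y → F y) → JoinedTo z E a w → JoinedTo z F a w
  JoinedTo-map f (inj₁ (a≡z , e)) = inj₁ (a≡z , f e)
  JoinedTo-map f (inj₂ (w≡z , e)) = inj₂ (w≡z , f e)

  Neighbours-sym : ∀ {xs x y} → Neighbours xs x y → Neighbours xs y x
  Neighbours-sym (inj₁ c) = inj₂ c
  Neighbours-sym (inj₂ c) = inj₁ c

  CyclicNeighbours-sym : ∀ {xs x y} → CyclicNeighbours xs x y → CyclicNeighbours xs y x
  CyclicNeighbours-sym (inj₁ p) = inj₁ (Neighbours-sym p)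
  CyclicNeighbours-sym (inj₂ (inj₁ q)) = inj₂ (inj₂ q)
  CyclicNeighbours-sym (inj₂ (inj₂ q)) = inj₂ (inj₁ q)

  Consecutive-∈ˡ : ∀ {xs x y} → Consecutive xs x y → x ∈ xs
  Consecutive-∈ˡ here = here refl
  Consecutive-∈ˡ (there c) = there (Consecutive-∈ˡ c)

  Consecutive-∈ʳ : ∀ {xs x y} → Consecutive xs x y → y ∈ xs
  Consecutive-∈ʳ here = there (here refl)
  Consecutive-∈ʳ (there c) = there (Consecutive-∈ʳ c)

  Last-∈ : ∀ {xs x} → Last xs x → x ∈ xs
  Last-∈ here = here refl
  Last-∈ (there l) = there (Last-∈ l)

  Head-∈ : ∀ {xs x} → Head xs x → x ∈ xs
  Head-∈ (_ , refl) = here refl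

  Neighbours-∈ : ∀ {xs x y} → Neighbours xs x y → y ∈ xs
  Neighbours-∈ (inj₁ c) = Consecutive-∈ʳ c
  Neighbours-∈ (inj₂ c) = Consecutive-∈ˡ c

  CyclicNeighbours-∈ : ∀ {xs x y} → CyclicNeighbours xs x y → y ∈ xs
  CyclicNeighbours-∈ (inj₁ p) = Neighbours-∈ p
  CyclicNeighbours-∈ (inj₂ (inj₁ (_ , h))) = Head-∈ h
  CyclicNeighbours-∈ (inj₂ (inj₂ (l , _))) = Last-∈ l

  Last-∷ʳ : ∀ xs {x} → Last (xs ∷ʳ x) x
  Last-∷ʳ [] = here
  Last-∷ʳ (_ ∷ xs) = there (Last-∷ʳ xs)

  Last-∷ʳ⁻ : ∀ xs {x y} → Last (xs ∷ʳ x) y → y ≡ x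
  Last-∷ʳ⁻ [] here = refl
  Last-∷ʳ⁻ (_ ∷ []) (there l) = Last-∷ʳ⁻ [] l
  Last-∷ʳ⁻ (_ ∷ x′ ∷ xs) (there l) = Last-∷ʳ⁻ (x′ ∷ xs) l

  Last⇒∷ʳ : ∀ {xs x} → Last xs x → ∃ λ ys → xs ≡ ys ∷ʳ x
  Last⇒∷ʳ here = [] , refl
  Last⇒∷ʳ (there {z} l) with ys , refl ← Last⇒∷ʳ l = z ∷ ys , refl

  Last-unique : ∀ {xs x y} → Last xs x → Last xs y → x ≡ y
  Last-unique lx ly with ys , refl ← Last⇒∷ʳ lx = sym (Last-∷ʳ⁻ ys ly)

  Head-unique : ∀ {xs x y} → Head xs x → Head xs y → x ≡ y
  Head-unique (_ , refl) (_ , refl) = refl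

  Last-exists : ∀ x xs → ∃ λ y → Last (x ∷ xs) y
  Last-exists x [] = x , here
  Last-exists x (x′ ∷ xs) with y , l ← Last-exists x′ xs = y , there l

  Consecutive-++ˡ : ∀ {xs ys x y} → Consecutive xs x y → Consecutive (xs ++ ys) x y
  Consecutive-++ˡ here = here
  Consecutive-++ˡ (there c) = there (Consecutive-++ˡ c)

  Consecutive-++ʳ : ∀ xs {ys x y} → Consecutive ys x y → Consecutive (xs ++ ys) x y
  Consecutive-++ʳ [] c = c
  Consecutive-++ʳ (_ ∷ xs) c = there (Consecutive-++ʳ xs c)

  Consecutive-join : ∀ {xs x y ys} → Last xs x → Consecutive (xs ++ y ∷ ys) x y
  Consecutive-join here = here
  Consecutive-join (there l) = there (Consecutive-join l)

  Consecutive-++⁻ : ∀ xs {ys x y} → Consecutive (xs ++ ys) x y →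
    Consecutive xs x y ⊎ Consecutive ys x y ⊎ (Last xs x × Head ys y)
  Consecutive-++⁻ [] c = inj₂ (inj₁ c)
  Consecutive-++⁻ (_ ∷ []) {_ ∷ ys} here = inj₂ (inj₂ (here , ys , refl))
  Consecutive-++⁻ (_ ∷ []) (there c) = inj₂ (inj₁ c)
  Consecutive-++⁻ (_ ∷ _ ∷ xs) here = inj₁ here
  Consecutive-++⁻ (_ ∷ x′ ∷ xs) (there c) with Consecutive-++⁻ (x′ ∷ xs) c
  ... | inj₁ c′ = inj₁ (there c′)
  ... | inj₂ (inj₁ c′) = inj₂ (inj₁ c′)
  ... | inj₂ (inj₂ (l , h)) = inj₂ (inj₂ (there l , h))

  Consecutive-reverse : ∀ {xs x y} → Consecutive xs x y → Consecutive (reverse xs) y x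
  Consecutive-reverse {x ∷ y ∷ xs} here
    rewrite unfold-reverse x (y ∷ xs) | unfold-reverse y xs
          | ++-assoc (reverse xs) [ y ] [ x ] = Consecutive-++ʳ (reverse xs) here
  Consecutive-reverse {z ∷ xs} (there c)
    rewrite unfold-reverse z xs = Consecutive-++ˡ (Consecutive-reverse c)

  Consecutive-reverse⁻ : ∀ {xs x y} → Consecutive (reverse xs) y x → Consecutive xs x y
  Consecutive-reverse⁻ {xs} c = subst (λ zs → Consecutive zs _ _) (reverse-involutive xs)
                                      (Consecutive-reverse c)

  Last⇒Head-reverse : ∀ {xs x} → Last xs x → Head (reverse xs) x
  Last⇒Head-reverse l with ys , refl ← Last⇒∷ʳ l = reverse ys , reverse-++ ys [ _ ]

  Head⇒Last-reverse : ∀ {xs x} → Head xs x → Last (reverse xs) x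
  Head⇒Last-reverse {x = x} (ys , refl)
    rewrite unfold-reverse x ys = Last-∷ʳ (reverse ys)

  Neighbours-reverse : ∀ {xs x y} → Neighbours xs x y → Neighbours (reverse xs) x y
  Neighbours-reverse (inj₁ c) = inj₂ (Consecutive-reverse c)
  Neighbours-reverse (inj₂ c) = inj₁ (Consecutive-reverse c)

  Neighbours-reverse⁻ : ∀ {xs x y} → Neighbours (reverse xs) x y → Neighbours xs x y
  Neighbours-reverse⁻ (inj₁ c) = inj₂ (Consecutive-reverse⁻ c)
  Neighbours-reverse⁻ (inj₂ c) = inj₁ (Consecutive-reverse⁻ c)

  Unique-resp-↭ : ∀ {xs ys : List A} → xs ↭ ys → Unique xs → Unique ys
  Unique-resp-↭ ↭-≡ u = u
  Unique-resp-↭ (↭-∷ x p) (x∉ ∷ u) = All-resp-↭ p x∉ ∷ Unique-resp-↭ p u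
  Unique-resp-↭ (↭-swap x y p) ((x≢y ∷ x∉) ∷ y∉ ∷ u) =
    (≢-sym x≢y ∷ All-resp-↭ p y∉) ∷ All-resp-↭ p x∉ ∷ Unique-resp-↭ p u
  Unique-resp-↭ (↭-∘ p q) u = Unique-resp-↭ q (Unique-resp-↭ p u)

  Unique-++⁻ˡ : ∀ (xs : List A) {ys} → Unique (xs ++ ys) → Unique xs
  Unique-++⁻ˡ [] u = []
  Unique-++⁻ˡ (_ ∷ xs) (x∉ ∷ u) =
    All.tabulate (λ y∈ → All.lookup x∉ (∈-++⁺ˡ y∈)) ∷ Unique-++⁻ˡ xs u

  Unique-++⁻ʳ : ∀ (xs : List A) {ys} → Unique (xs ++ ys) → Unique ys
  Unique-++⁻ʳ [] u = u
  Unique-++⁻ʳ (_ ∷ xs) (_ ∷ u) = Unique-++⁻ʳ xs u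

  Unique-++-disjoint : ∀ (xs : List A) {ys x y} → Unique (xs ++ ys) → x ∈ xs → y ∈ ys → x ≢ y
  Unique-++-disjoint (_ ∷ xs) (x∉ ∷ _) (here refl) y∈ = All.lookup x∉ (∈-++⁺ʳ xs y∈)
  Unique-++-disjoint (_ ∷ xs) (_ ∷ u) (there x∈) y∈ = Unique-++-disjoint xs u x∈ y∈

  private
    inner-neighbours : ∀ (x : A) xs {y z ys} → Unique ((x ∷ xs) ++ y ∷ z ∷ ys) →
      ∃₂ λ w₁ w₂ → w₁ ≢ w₂ × Neighbours ((x ∷ xs) ++ y ∷ z ∷ ys) y w₁
                            × Neighbours ((x ∷ xs) ++ y ∷ z ∷ ys) y w₂
    inner-neighbours x xs u with w , l ← Last-exists x xs =
      w , _ , Unique-++-disjoint (x ∷ xs) u (Last-∈ l) (there (here refl)) ,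
      inj₂ (Consecutive-join l) , inj₁ (Consecutive-++ʳ (x ∷ xs) here)

  endpoint : ∀ {xs : List A} {y} → Unique xs → y ∈ xs →
    (∀ w₁ w₂ → w₁ ≢ w₂ → Neighbours xs y w₁ → Neighbours xs y w₂ → ⊥) →
    Ends xs xs y
  endpoint u y∈ ≤1-neighbour with ∈-∃++ y∈
  ... | [] , zs , refl = inj₂ (zs , refl)
  ... | x ∷ xs , [] , refl = inj₁ (Last-∷ʳ (x ∷ xs))
  ... | x ∷ xs , z ∷ zs , refl with w₁ , w₂ , w₁≢w₂ , n₁ , n₂ ← inner-neighbours x xs u =
    ⊥-elim (≤1-neighbour w₁ w₂ w₁≢w₂ n₁ n₂)

  cyclic-neighbours : ∀ {xs : List A} {y} → Unique xs → 3 ≤ length xs → y ∈ xs →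
    ∃₂ λ w₁ w₂ → w₁ ≢ w₂ × CyclicNeighbours xs y w₁ × CyclicNeighbours xs y w₂
  cyclic-neighbours u len y∈ with ∈-∃++ y∈
  cyclic-neighbours u (s≤s ()) _ | [] , [] , refl
  cyclic-neighbours u (s≤s (s≤s ())) _ | [] , _ ∷ [] , refl
  cyclic-neighbours (y∉ ∷ u) _ _ | [] , z ∷ z′ ∷ zs , refl
    with w , l ← Last-exists z′ zs =
    z , w , z≢w u , inj₁ (inj₁ here) , inj₂ (inj₂ (there (there l) , _ , refl))
    where
    z≢w : Unique (z ∷ z′ ∷ zs) → z ≢ w
    z≢w (z∉ ∷ _) = All.lookup z∉ (Last-∈ l)
  cyclic-neighbours u (s≤s (s≤s ())) _ | _ ∷ [] , [] , refl
  cyclic-neighbours (x∉ ∷ _) _ _ | x ∷ x′ ∷ xs , [] , refl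
    with w , l ← Last-exists x′ xs =
    w , x , ≢-sym (All.lookup x∉ (∈-++⁺ˡ (Last-∈ l))) , inj₁ (inj₂ (Consecutive-join (there l))) ,
    inj₂ (inj₁ (Last-∷ʳ (x ∷ x′ ∷ xs) , _ , refl))
  cyclic-neighbours u _ _ | x ∷ xs , z ∷ zs , refl
    with w₁ , w₂ , w₁≢w₂ , n₁ , n₂ ← inner-neighbours x xs u =
    w₁ , w₂ , w₁≢w₂ , inj₁ n₁ , inj₁ n₂

  Consecutive-lookup : ∀ xs (i j : Fin (length xs)) → suc (toℕ i) ≡ toℕ j →
    Consecutive xs (lookup xs i) (lookup xs j)
  Consecutive-lookup (_ ∷ _ ∷ _) fzero (fsuc fzero) _ = here
  Consecutive-lookup (_ ∷ y ∷ xs) (fsuc i) (fsuc j) e =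
    there (Consecutive-lookup (y ∷ xs) i j (suc-injective e))
  Consecutive-lookup (_ ∷ []) fzero (fsuc ()) _
  Consecutive-lookup (_ ∷ []) (fsuc ()) _ _

  Consecutive-positions : ∀ {xs x y} → Consecutive xs x y →
    ∃₂ λ (i j : Fin (length xs)) → lookup xs i ≡ x × lookup xs j ≡ y × suc (toℕ i) ≡ toℕ j
  Consecutive-positions here = fzero , fsuc fzero , refl , refl , refl
  Consecutive-positions (there c) with i , j , p , q , r ← Consecutive-positions c =
    fsuc i , fsuc j , p , q , cong suc r

  Last-lookup : ∀ xs (j : Fin (length xs)) → suc (toℕ j) ≡ length xs → Last xs (lookup xs j)
  Last-lookup (_ ∷ []) fzero refl = here
  Last-lookup (_ ∷ y ∷ xs) (fsuc j) e = there (Last-lookup (y ∷ xs) j (suc-injective e))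

  Last-position : ∀ {xs x} → Last xs x →
    ∃ λ (j : Fin (length xs)) → lookup xs j ≡ x × suc (toℕ j) ≡ length xs
  Last-position here = fzero , refl , refl
  Last-position (there l) with j , p , q ← Last-position l = fsuc j , p , cong suc q

  Head-lookup : ∀ xs (i : Fin (length xs)) → toℕ i ≡ 0 → Head xs (lookup xs i)
  Head-lookup (_ ∷ xs) fzero _ = xs , refl

  Head-position : ∀ {xs x} → Head xs x → ∃ λ (i : Fin (length xs)) → lookup xs i ≡ x × toℕ i ≡ 0
  Head-position (_ , refl) = fzero , refl , refl

  lookup-injective : ∀ {xs : List A} → Unique xs → ∀ (i j : Fin (length xs)) →
    lookup xs i ≡ lookup xs j → i ≡ j
  lookup-injective {_ ∷ _} _ fzero fzero _ = refl
  lookup-injective {_ ∷ _} (x∉ ∷ _) fzero (fsuc j) e = ⊥-elim (All.lookup x∉ (∈-lookup j) e)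
  lookup-injective {_ ∷ _} (x∉ ∷ _) (fsuc i) fzero e = ⊥-elim (All.lookup x∉ (∈-lookup i) (sym e))
  lookup-injective {_ ∷ _} (_ ∷ u) (fsuc i) (fsuc j) e = cong fsuc (lookup-injective u i j e)

  private
    Consecutive-++-∷⁻ : ∀ xs {z ys a w} → Consecutive (xs ++ z ∷ ys) a w →
      Consecutive xs a w ⊎ Consecutive ys a w ⊎ (a ≡ z × Head ys w) ⊎ (w ≡ z × Last xs a)
    Consecutive-++-∷⁻ xs c with Consecutive-++⁻ xs c
    ... | inj₁ c′ = inj₁ c′
    ... | inj₂ (inj₁ here) = inj₂ (inj₂ (inj₁ (refl , _ , refl)))
    ... | inj₂ (inj₁ (there c′)) = inj₂ (inj₁ c′)
    ... | inj₂ (inj₂ (l , _ , refl)) = inj₂ (inj₂ (inj₂ (refl , l)))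

  Neighbours-++-∷⁻ : ∀ xs {z ys a w} → Neighbours (xs ++ z ∷ ys) a w →
    Neighbours xs a w ⊎ Neighbours ys a w ⊎ JoinedTo z (Ends xs ys) a w
  Neighbours-++-∷⁻ xs (inj₁ c) with Consecutive-++-∷⁻ xs c
  ... | inj₁ c′ = inj₁ (inj₁ c′)
  ... | inj₂ (inj₁ c′) = inj₂ (inj₁ (inj₁ c′))
  ... | inj₂ (inj₂ (inj₁ (a≡z , h))) = inj₂ (inj₂ (inj₁ (a≡z , inj₂ h)))
  ... | inj₂ (inj₂ (inj₂ (w≡z , l))) = inj₂ (inj₂ (inj₂ (w≡z , inj₁ l)))
  Neighbours-++-∷⁻ xs (inj₂ c) with Consecutive-++-∷⁻ xs c
  ... | inj₁ c′ = inj₁ (inj₂ c′)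
  ... | inj₂ (inj₁ c′) = inj₂ (inj₁ (inj₂ c′))
  ... | inj₂ (inj₂ (inj₁ (w≡z , h))) = inj₂ (inj₂ (inj₂ (w≡z , inj₂ h)))
  ... | inj₂ (inj₂ (inj₂ (a≡z , l))) = inj₂ (inj₂ (inj₁ (a≡z , inj₁ l)))

  Neighbours-++-∷⁺ : ∀ xs {z ys a w} →
    Neighbours xs a w ⊎ Neighbours ys a w ⊎ JoinedTo z (Ends xs ys) a w →
    Neighbours (xs ++ z ∷ ys) a w
  Neighbours-++-∷⁺ xs (inj₁ (inj₁ c)) = inj₁ (Consecutive-++ˡ c)
  Neighbours-++-∷⁺ xs (inj₁ (inj₂ c)) = inj₂ (Consecutive-++ˡ c)
  Neighbours-++-∷⁺ xs (inj₂ (inj₁ (inj₁ c))) = inj₁ (Consecutive-++ʳ xs (there c))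
  Neighbours-++-∷⁺ xs (inj₂ (inj₁ (inj₂ c))) = inj₂ (Consecutive-++ʳ xs (there c))
  Neighbours-++-∷⁺ xs (inj₂ (inj₂ (inj₁ (refl , inj₁ l)))) = inj₂ (Consecutive-join l)
  Neighbours-++-∷⁺ xs (inj₂ (inj₂ (inj₁ (refl , inj₂ (_ , refl))))) = inj₁ (Consecutive-++ʳ xs here)
  Neighbours-++-∷⁺ xs (inj₂ (inj₂ (inj₂ (refl , inj₁ l)))) = inj₁ (Consecutive-join l)
  Neighbours-++-∷⁺ xs (inj₂ (inj₂ (inj₂ (refl , inj₂ (_ , refl))))) = inj₂ (Consecutive-++ʳ xs here)

  CyclicNeighbours-∷⁻ : ∀ {z x xs a w} → CyclicNeighbours (z ∷ x ∷ xs) a w →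
    Neighbours (x ∷ xs) a w ⊎ JoinedTo z (Ends (x ∷ xs) (x ∷ xs)) a w
  CyclicNeighbours-∷⁻ (inj₁ (inj₁ here)) = inj₂ (inj₁ (refl , inj₂ (_ , refl)))
  CyclicNeighbours-∷⁻ (inj₁ (inj₁ (there c))) = inj₁ (inj₁ c)
  CyclicNeighbours-∷⁻ (inj₁ (inj₂ here)) = inj₂ (inj₂ (refl , inj₂ (_ , refl)))
  CyclicNeighbours-∷⁻ (inj₁ (inj₂ (there c))) = inj₁ (inj₂ c)
  CyclicNeighbours-∷⁻ (inj₂ (inj₁ (there l , _ , refl))) = inj₂ (inj₂ (refl , inj₁ l))
  CyclicNeighbours-∷⁻ (inj₂ (inj₂ (there l , _ , refl))) = inj₂ (inj₁ (refl , inj₁ l))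

  CyclicNeighbours-∷⁺ : ∀ {z xs a w} →
    Neighbours xs a w ⊎ JoinedTo z (Ends xs xs) a w → CyclicNeighbours (z ∷ xs) a w
  CyclicNeighbours-∷⁺ (inj₁ (inj₁ c)) = inj₁ (inj₁ (there c))
  CyclicNeighbours-∷⁺ (inj₁ (inj₂ c)) = inj₁ (inj₂ (there c))
  CyclicNeighbours-∷⁺ (inj₂ (inj₁ (refl , inj₁ l))) = inj₂ (inj₂ (there l , _ , refl))
  CyclicNeighbours-∷⁺ (inj₂ (inj₁ (refl , inj₂ (_ , refl)))) = inj₁ (inj₁ here)
  CyclicNeighbours-∷⁺ (inj₂ (inj₂ (refl , inj₁ l))) = inj₂ (inj₁ (there l , _ , refl))
  CyclicNeighbours-∷⁺ (inj₂ (inj₂ (refl , inj₂ (_ , refl)))) = inj₁ (inj₂ here)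


-- Covering a graph of maximum degree two by paths and cycles

Adj-sym : ∀ {n} (G : FinGraph n) {x y} → Adj G x y → Adj G y x
Adj-sym G {x} {y} = trans (FinGraph.sym G y x)

Adj-irrefl : ∀ {n} (G : FinGraph n) {x} → ¬ Adj G x x
Adj-irrefl G {x} xx with () ← trans (sym xx) (FinGraph.irrefl G x)

MaxDegree≤2 : ∀ {n} → FinGraph n → Set
MaxDegree≤2 {n} D = ∀ x (y₁ y₂ y₃ : Fin n) → y₁ ≢ y₂ → y₁ ≢ y₃ → y₂ ≢ y₃ →
  ¬ (Adj D x y₁ × Adj D x y₂ × Adj D x y₃)

module PathCycleDecomposition {n} (D : FinGraph n) (degree≤2 : MaxDegree≤2 D) where

  data Piece : Set where
    path  : List (Fin n) → Piece
    cycle : Fin n → Fin n → Fin n → List (Fin n) → Piece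

  vertices : Piece → List (Fin n)
  vertices (path xs) = xs
  vertices (cycle x y z xs) = x ∷ y ∷ z ∷ xs

  Linked : Piece → Fin n → Fin n → Set
  Linked (path xs) = Neighbours xs
  Linked (cycle x y z xs) = CyclicNeighbours (x ∷ y ∷ z ∷ xs)

  allVertices : List Piece → List (Fin n)
  allVertices [] = []
  allVertices (p ∷ Ps) = vertices p ++ allVertices Ps

  LinkedIn : List Piece → Fin n → Fin n → Set
  LinkedIn Ps x y = Any (λ p → Linked p x y) Ps

  Linked-sym : ∀ p {x y} → Linked p x y → Linked p y x
  Linked-sym (path _) = Neighbours-sym
  Linked-sym (cycle _ _ _ _) = CyclicNeighbours-sym

  LinkedIn-sym : ∀ Ps {x y} → LinkedIn Ps x y → LinkedIn Ps y x
  LinkedIn-sym (p ∷ _) (here l) = here (Linked-sym p l)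
  LinkedIn-sym (_ ∷ Ps) (there l) = there (LinkedIn-sym Ps l)

  Linked-∈ : ∀ p {x y} → Linked p x y → y ∈ vertices p
  Linked-∈ (path _) = Neighbours-∈
  Linked-∈ (cycle _ _ _ _) = CyclicNeighbours-∈

  ∈-allVertices⁻ : ∀ Ps {x} → x ∈ allVertices Ps → ∃ λ p → p ∈ Ps × x ∈ vertices p
  ∈-allVertices⁻ (p ∷ Ps) x∈ with ∈-++⁻ (vertices p) x∈
  ... | inj₁ x∈p = p , here refl , x∈p
  ... | inj₂ x∈Ps with p′ , p′∈ , x∈p′ ← ∈-allVertices⁻ Ps x∈Ps = p′ , there p′∈ , x∈p′

  LinkedIn-∈ : ∀ Ps {x y} → LinkedIn Ps x y → y ∈ allVertices Ps
  LinkedIn-∈ (p ∷ _) (here l) = ∈-++⁺ˡ (Linked-∈ p l)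
  LinkedIn-∈ (p ∷ Ps) (there l) = ∈-++⁺ʳ (vertices p) (LinkedIn-∈ Ps l)

  allVertices-↭ : ∀ {Ps Qs} → Ps ↭ Qs → allVertices Ps ↭ allVertices Qs
  allVertices-↭ ↭-≡ = ↭-refl
  allVertices-↭ (↭-∷ p Ps↭Qs) = ++⁺ˡ (vertices p) (allVertices-↭ Ps↭Qs)
  allVertices-↭ (↭-swap p q Ps↭Qs) =
    ↭-trans (shifts (vertices p) (vertices q)) (++⁺ˡ (vertices q) (++⁺ˡ (vertices p) (allVertices-↭ Ps↭Qs)))
  allVertices-↭ (↭-∘ p q) = ↭-trans (allVertices-↭ p) (allVertices-↭ q)

  extract : ∀ {Ps : List Piece} {p} → p ∈ Ps → ∃ λ R → Ps ↭ p ∷ R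
  extract p∈ with ys , zs , refl ← ∈-∃++ p∈ = ys ++ zs , shift _ ys zs

  Unique-piece : ∀ {Ps : List Piece} {p} → Unique (allVertices Ps) → p ∈ Ps → Unique (vertices p)
  Unique-piece {p = p} u p∈ =
    Unique-++⁻ˡ (vertices p) (Unique-resp-↭ (allVertices-↭ (proj₂ (extract p∈))) u)

  -- Ps consists of the path xs, in either orientation and possibly empty, and the pieces R
  record PathSplit (Ps : List Piece) (xs : List (Fin n)) (R : List Piece) : Set where
    field
      vertices-↭ : allVertices Ps ↭ xs ++ allVertices R
      linked⁻    : ∀ {a w} → LinkedIn Ps a w → Neighbours xs a w ⊎ LinkedIn R a w
      linked⁺    : ∀ {a w} → Neighbours xs a w ⊎ LinkedIn R a w → LinkedIn Ps a w

  emptySplit : ∀ {Ps} → PathSplit Ps [] Ps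
  emptySplit = record
    { vertices-↭ = ↭-refl
    ; linked⁻ = inj₂
    ; linked⁺ = λ { (inj₁ (inj₁ ())) ; (inj₁ (inj₂ ())) ; (inj₂ l) → l } }

  PathSplit-∈ : ∀ {Ps : List Piece} {xs} → path xs ∈ Ps → ∃ λ R → PathSplit Ps xs R
  PathSplit-∈ p∈ with R , Ps↭ ← extract p∈ = R , record
    { vertices-↭ = allVertices-↭ Ps↭
    ; linked⁻ = λ l → toSum (Any-resp-↭ Ps↭ l)
    ; linked⁺ = λ l → Any-resp-↭ (↭-sym Ps↭) (fromSum l) }

  PathSplit-reverse : ∀ {Ps xs R} → PathSplit Ps xs R → PathSplit Ps (reverse xs) R
  PathSplit-reverse {xs = xs} S = record
    { vertices-↭ = ↭-trans vertices-↭ (++⁺ʳ _ (↭-sym (↭-reverse xs)))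
    ; linked⁻ = λ l → map₁ Neighbours-reverse (linked⁻ l)
    ; linked⁺ = λ l → linked⁺ (map₁ Neighbours-reverse⁻ l) }
    where open PathSplit S

  record Decomposition (k : ℕ) (Ps : List Piece) : Set where
    field
      unique   : Unique (allVertices Ps)
      bounded  : ∀ {x} → x ∈ allVertices Ps → toℕ x < k
      covers   : ∀ {x} → toℕ x < k → x ∈ allVertices Ps
      sound    : ∀ {x y} → LinkedIn Ps x y → Adj D x y
      complete : ∀ {x y} → toℕ x < k → toℕ y < k → Adj D x y → LinkedIn Ps x y

  empty : Decomposition 0 []
  empty = record
    { unique = [] ; bounded = λ () ; covers = λ () ; sound = λ ()
    ; complete = λ () }

  module Extension {k Ps} (dec : Decomposition k Ps) (z : Fin n) (z≡k : toℕ z ≡ k) where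
    open Decomposition dec

    EarlierNeighbour : Fin n → Set
    EarlierNeighbour y = toℕ y < k × Adj D z y

    z∉ : ∀ {x} → x ∈ allVertices Ps → x ≢ z
    z∉ x∈ refl = <-irrefl z≡k (bounded x∈)

    <suc⇒<⊎≡z : ∀ {x} → toℕ x < suc k → toℕ x < k ⊎ x ≡ z
    <suc⇒<⊎≡z x<1+k with m≤n⇒m<n∨m≡n (≤-pred x<1+k)
    ... | inj₁ x<k = inj₁ x<k
    ... | inj₂ x≡k = inj₂ (toℕ-injective (trans x≡k (sym z≡k)))

    extend : ∀ Qs → allVertices Qs ↭ z ∷ allVertices Ps →
      (∀ {a w} → LinkedIn Qs a w → LinkedIn Ps a w ⊎ JoinedTo z EarlierNeighbour a w) →
      (∀ {a w} → LinkedIn Ps a w → LinkedIn Qs a w) →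
      (∀ {y} → EarlierNeighbour y → LinkedIn Qs z y) → Decomposition (suc k) Qs
    extend Qs Qs↭ old⊎new old new = record
      { unique = Unique-resp-↭ (↭-sym Qs↭) (All.tabulate (λ x∈ → ≢-sym (z∉ x∈)) ∷ unique)
      ; bounded = bounded′
      ; covers = covers′
      ; sound = sound′
      ; complete = complete′ }
      where
      bounded′ : ∀ {x} → x ∈ allVertices Qs → toℕ x < suc k
      bounded′ x∈ with ∈-resp-↭ Qs↭ x∈
      ... | here refl = s≤s (subst (_≤ k) (sym z≡k) ≤-refl)
      ... | there x∈Ps = ≤-trans (bounded x∈Ps) (n≤1+n k)
      covers′ : ∀ {x} → toℕ x < suc k → x ∈ allVertices Qs
      covers′ x< with <suc⇒<⊎≡z x<
      ... | inj₁ x<k = ∈-resp-↭ (↭-sym Qs↭) (there (covers x<k))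
      ... | inj₂ refl = ∈-resp-↭ (↭-sym Qs↭) (here refl)
      sound′ : ∀ {x y} → LinkedIn Qs x y → Adj D x y
      sound′ l with old⊎new l
      ... | inj₁ l′ = sound l′
      ... | inj₂ (inj₁ (refl , _ , zy)) = zy
      ... | inj₂ (inj₂ (refl , _ , zx)) = Adj-sym D zx
      complete′ : ∀ {x y} → toℕ x < suc k → toℕ y < suc k → Adj D x y → LinkedIn Qs x y
      complete′ {x} {y} x< y< xy with <suc⇒<⊎≡z x< | <suc⇒<⊎≡z y<
      ... | inj₁ x<k | inj₁ y<k = old (complete x<k y<k xy)
      ... | inj₁ x<k | inj₂ refl = LinkedIn-sym Qs (new (x<k , Adj-sym D xy))
      ... | inj₂ refl | inj₁ y<k = new (y<k , xy)
      ... | inj₂ refl | inj₂ refl = ⊥-elim (Adj-irrefl D xy)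

    record Part (Qs : List Piece) : Set where
      field
        unique : Unique (allVertices Qs)
        linked : ∀ {a w} → LinkedIn Qs a w → LinkedIn Ps a w

    whole : Part Ps
    whole = record { unique = unique ; linked = λ l → l }

    Part-rest : ∀ {Qs xs R} → Part Qs → PathSplit Qs xs R → Part R
    Part-rest {xs = xs} Q S = record
      { unique = Unique-++⁻ʳ xs (Unique-resp-↭ (PathSplit.vertices-↭ S) (Part.unique Q))
      ; linked = λ l → Part.linked Q (PathSplit.linked⁺ S (inj₂ l)) }

    -- z uses up one of the two links available at each of its neighbours
    no-two-links : ∀ (L : Fin n → Fin n → Set) → (∀ {a w} → L a w → LinkedIn Ps a w) →
      ∀ {y} → EarlierNeighbour y → ∀ {w₁ w₂} → w₁ ≢ w₂ → L y w₁ → L y w₂ → ⊥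
    no-two-links L L⊆ (_ , zy) w₁≢w₂ l₁ l₂ =
      degree≤2 _ _ _ z w₁≢w₂ (z∉ (LinkedIn-∈ Ps (L⊆ l₁))) (z∉ (LinkedIn-∈ Ps (L⊆ l₂)))
        (sound (L⊆ l₁) , sound (L⊆ l₂) , Adj-sym D zy)

    earlierNeighbour-end : ∀ {Qs xs R y} → Part Qs → PathSplit Qs xs R → EarlierNeighbour y → y ∈ xs →
      Ends xs xs y
    earlierNeighbour-end {xs = xs} Q S e y∈ =
      endpoint (Unique-++⁻ˡ xs (Unique-resp-↭ (PathSplit.vertices-↭ S) (Part.unique Q))) y∈
        (λ _ _ w₁≢w₂ → no-two-links (Neighbours xs) (Part.linked Q ∘ PathSplit.linked⁺ S ∘ inj₁) e w₁≢w₂)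

    earlierNeighbour-pathEnd : ∀ {Qs y} → Part Qs → EarlierNeighbour y → y ∈ allVertices Qs →
      ∃₂ λ xs R → PathSplit Qs xs R × Head xs y
    earlierNeighbour-pathEnd {Qs} Q e y∈ with ∈-allVertices⁻ Qs y∈
    ... | p@(cycle _ _ _ _) , p∈ , y∈p
      with w₁ , w₂ , w₁≢w₂ , l₁ , l₂ ←
             cyclic-neighbours (Unique-piece (Part.unique Q) p∈) (s≤s (s≤s (s≤s z≤n))) y∈p =
      ⊥-elim (no-two-links (Linked p) (λ l → Part.linked Q (lose p∈ l)) e w₁≢w₂ l₁ l₂)
    ... | path xs , p∈ , y∈xs with R , S ← PathSplit-∈ p∈ with earlierNeighbour-end Q S e y∈xs
    ...   | inj₂ h = xs , R , S , h
    ...   | inj₁ l = reverse xs , R , PathSplit-reverse S , Last⇒Head-reverse l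

    join : ∀ {xs₁ R₁ xs₂ R₂} → PathSplit Ps xs₁ R₁ → PathSplit R₁ xs₂ R₂ →
      (∀ {y} → EarlierNeighbour y → Ends xs₁ xs₂ y) → (∀ {y} → Ends xs₁ xs₂ y → EarlierNeighbour y) →
      Decomposition (suc k) (path (xs₁ ++ z ∷ xs₂) ∷ R₂)
    join {xs₁} {R₁} {xs₂} {R₂} S₁ S₂ attach attach⁻ =
      extend _ vertices-↭ old⊎new old
        (λ e → here (Neighbours-++-∷⁺ xs₁ (inj₂ (inj₂ (inj₁ (refl , attach e))))))
      where
      module S₁ = PathSplit S₁
      module S₂ = PathSplit S₂
      open PermutationReasoning
      vertices-↭ : (xs₁ ++ z ∷ xs₂) ++ allVertices R₂ ↭ z ∷ allVertices Ps
      vertices-↭ = begin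
        (xs₁ ++ z ∷ xs₂) ++ allVertices R₂  ≡⟨ ++-assoc xs₁ (z ∷ xs₂) _ ⟩
        xs₁ ++ z ∷ xs₂ ++ allVertices R₂    ↭⟨ shift z xs₁ _ ⟩
        z ∷ xs₁ ++ xs₂ ++ allVertices R₂    ↭⟨ ↭-prep z (++⁺ˡ xs₁ (↭-sym S₂.vertices-↭)) ⟩
        z ∷ xs₁ ++ allVertices R₁           ↭⟨ ↭-prep z (↭-sym S₁.vertices-↭) ⟩
        z ∷ allVertices Ps                  ∎
      old⊎new : ∀ {a w} → LinkedIn (path (xs₁ ++ z ∷ xs₂) ∷ R₂) a w →
        LinkedIn Ps a w ⊎ JoinedTo z EarlierNeighbour a w
      old⊎new (there l) = inj₁ (S₁.linked⁺ (inj₂ (S₂.linked⁺ (inj₂ l))))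
      old⊎new (here nb) with Neighbours-++-∷⁻ xs₁ nb
      ... | inj₁ nb₁ = inj₁ (S₁.linked⁺ (inj₁ nb₁))
      ... | inj₂ (inj₁ nb₂) = inj₁ (S₁.linked⁺ (inj₂ (S₂.linked⁺ (inj₁ nb₂))))
      ... | inj₂ (inj₂ j) = inj₂ (JoinedTo-map attach⁻ j)
      old : ∀ {a w} → LinkedIn Ps a w → LinkedIn (path (xs₁ ++ z ∷ xs₂) ∷ R₂) a w
      old l with S₁.linked⁻ l
      ... | inj₁ nb₁ = here (Neighbours-++-∷⁺ xs₁ (inj₁ nb₁))
      ... | inj₂ l₁ with S₂.linked⁻ l₁
      ...   | inj₁ nb₂ = here (Neighbours-++-∷⁺ xs₁ (inj₂ (inj₁ nb₂)))
      ...   | inj₂ l₂ = there l₂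

    close : ∀ {x x′ xs R} → PathSplit Ps (x ∷ x′ ∷ xs) R →
      (∀ {y} → EarlierNeighbour y → Ends (x ∷ x′ ∷ xs) (x ∷ x′ ∷ xs) y) →
      (∀ {y} → Ends (x ∷ x′ ∷ xs) (x ∷ x′ ∷ xs) y → EarlierNeighbour y) →
      Decomposition (suc k) (cycle z x x′ xs ∷ R)
    close S attach attach⁻ =
      extend _ (↭-prep z (↭-sym S.vertices-↭)) old⊎new old
        (λ e → here (CyclicNeighbours-∷⁺ (inj₂ (inj₁ (refl , attach e)))))
      where
      module S = PathSplit S
      old⊎new : ∀ {a w} → LinkedIn (cycle z _ _ _ ∷ _) a w → LinkedIn Ps a w ⊎ JoinedTo z EarlierNeighbour a w
      old⊎new (there l) = inj₁ (S.linked⁺ (inj₂ l))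
      old⊎new (here c) with CyclicNeighbours-∷⁻ c
      ... | inj₁ nb = inj₁ (S.linked⁺ (inj₁ nb))
      ... | inj₂ j = inj₂ (JoinedTo-map attach⁻ j)
      old : ∀ {a w} → LinkedIn Ps a w → LinkedIn (cycle z _ _ _ ∷ _) a w
      old l with S.linked⁻ l
      ... | inj₁ nb = here (CyclicNeighbours-∷⁺ (inj₁ nb))
      ... | inj₂ l′ = there l′

    attachBoth : ∀ {xs ys y₁ y₂} → Last xs y₁ → Head ys y₂ →
      (∀ {y} → EarlierNeighbour y → y ≡ y₁ ⊎ y ≡ y₂) → EarlierNeighbour y₁ → EarlierNeighbour y₂ →
      (∀ {y} → EarlierNeighbour y → Ends xs ys y) × (∀ {y} → Ends xs ys y → EarlierNeighbour y)
    attachBoth l₁ h₂ only e₁ e₂ = attach , attach⁻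
      where
      attach : ∀ {y} → EarlierNeighbour y → Ends _ _ y
      attach e with only e
      ... | inj₁ refl = inj₁ l₁
      ... | inj₂ refl = inj₂ h₂
      attach⁻ : ∀ {y} → Ends _ _ y → EarlierNeighbour y
      attach⁻ (inj₁ l) = subst EarlierNeighbour (Last-unique l₁ l) e₁
      attach⁻ (inj₂ h) = subst EarlierNeighbour (Head-unique h₂ h) e₂

    noNeighbour : (∀ {y} → ¬ EarlierNeighbour y) → ∃ (Decomposition (suc k))
    noNeighbour none = _ , join emptySplit emptySplit (λ e → ⊥-elim (none e)) λ { (inj₁ ()) ; (inj₂ (_ , ())) }

    oneNeighbour : ∀ {y} → EarlierNeighbour y → (∀ {y′} → EarlierNeighbour y′ → y′ ≡ y) →
      ∃ (Decomposition (suc k))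
    oneNeighbour e only with xs , R , S , h ← earlierNeighbour-pathEnd whole e (covers (proj₁ e)) =
      _ , join emptySplit S (λ e′ → inj₂ (subst (Head xs) (sym (only e′)) h))
            λ { (inj₁ ()) ; (inj₂ h′) → subst EarlierNeighbour (Head-unique h h′) e }

    twoNeighbours : ∀ {y₁ y₂} → y₁ ≢ y₂ → EarlierNeighbour y₁ → EarlierNeighbour y₂ →
      (∀ {y} → EarlierNeighbour y → y ≡ y₁ ⊎ y ≡ y₂) → ∃ (Decomposition (suc k))
    twoNeighbours {y₁} {y₂} y₁≢y₂ e₁ e₂ only
      with xs , _ , S , h ← earlierNeighbour-pathEnd whole e₁ (covers (proj₁ e₁)) =
      fromLast (PathSplit-reverse S) (Head⇒Last-reverse h)
      where
      closeAt : ∀ {xs₁ R₁} → PathSplit Ps xs₁ R₁ → Last xs₁ y₁ → Head xs₁ y₂ →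
        ∃ (Decomposition (suc k))
      closeAt S₁ l₁ ([] , refl) = ⊥-elim (y₁≢y₂ (Last-unique l₁ here))
      closeAt S₁ l₁ h₂@(_ ∷ _ , refl) = _ , close S₁ attach attach⁻
        where open Σ (attachBoth l₁ h₂ only e₁ e₂) renaming (proj₁ to attach; proj₂ to attach⁻)
      fromLast : ∀ {xs₁ R₁} → PathSplit Ps xs₁ R₁ → Last xs₁ y₁ → ∃ (Decomposition (suc k))
      fromLast {xs₁} S₁ l₁ with ∈-++⁻ xs₁ (∈-resp-↭ (PathSplit.vertices-↭ S₁) (covers (proj₁ e₂)))
      ... | inj₁ y₂∈xs₁ with earlierNeighbour-end whole S₁ e₂ y₂∈xs₁
      ...   | inj₁ l₂ = ⊥-elim (y₁≢y₂ (Last-unique l₁ l₂))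
      ...   | inj₂ h₂ = closeAt S₁ l₁ h₂
      fromLast S₁ l₁ | inj₂ y₂∈R₁
        with _ , _ , S₂ , h₂ ← earlierNeighbour-pathEnd (Part-rest whole S₁) e₂ y₂∈R₁ =
        _ , join S₁ S₂ attach attach⁻
        where open Σ (attachBoth l₁ h₂ only e₁ e₂) renaming (proj₁ to attach; proj₂ to attach⁻)

    earlierNeighbour? : ∀ y → Dec (EarlierNeighbour y)
    earlierNeighbour? y = (toℕ y <? k) ×-dec (adj D z y ≟ᵇ true)

    fromNeighbourList : ∀ ys → Unique ys → (∀ {y} → y ∈ ys → EarlierNeighbour y) →
      (∀ {y} → EarlierNeighbour y → y ∈ ys) → ∃ (Decomposition (suc k))
    fromNeighbourList [] _ _ ⇒∈ = noNeighbour (λ e → case ⇒∈ e of λ ())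
    fromNeighbourList (_ ∷ []) _ ∈⇒ ⇒∈ =
      oneNeighbour (∈⇒ (here refl)) (λ e → case ⇒∈ e of λ { (here eq) → eq })
    fromNeighbourList (_ ∷ _ ∷ []) ((y₁≢y₂ ∷ []) ∷ _) ∈⇒ ⇒∈ =
      twoNeighbours y₁≢y₂ (∈⇒ (here refl)) (∈⇒ (there (here refl)))
        (λ e → case ⇒∈ e of λ { (here eq) → inj₁ eq ; (there (here eq)) → inj₂ eq })
    fromNeighbourList (y₁ ∷ y₂ ∷ y₃ ∷ _) ((y₁≢y₂ ∷ y₁≢y₃ ∷ _) ∷ (y₂≢y₃ ∷ _) ∷ _) ∈⇒ _ =
      ⊥-elim (degree≤2 z y₁ y₂ y₃ y₁≢y₂ y₁≢y₃ y₂≢y₃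
        (proj₂ (∈⇒ (here refl)) , proj₂ (∈⇒ (there (here refl))) ,
         proj₂ (∈⇒ (there (there (here refl))))))

    extension : ∃ (Decomposition (suc k))
    extension = fromNeighbourList (filter earlierNeighbour? (allFin n))
      (Unique.filter⁺ earlierNeighbour? (Unique.allFin⁺ n))
      (λ y∈ → proj₂ (∈-filter⁻ earlierNeighbour? {xs = allFin n} y∈))
      (λ e → ∈-filter⁺ earlierNeighbour? (∈-allFin _) e)

  decompose : ∀ k → k ≤ n → ∃ (Decomposition k)
  decompose zero _ = [] , empty
  decompose (suc k) k<n =
    Extension.extension (proj₂ (decompose k (<⇒≤ k<n))) (fromℕ< k<n) (toℕ-fromℕ< k<n)

  decomposition : ∃ (Decomposition n)
  decomposition = decompose n ≤-refl

-- Path and cycle graphs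

isYes⇒ : ∀ {P : Set} (P? : Dec P) → isYes P? ≡ true → P
isYes⇒ (yes p) _ = p

⇒isYes : ∀ {P : Set} (P? : Dec P) → P → isYes P? ≡ true
⇒isYes (yes _) _ = refl
⇒isYes (no ¬p) p = ⊥-elim (¬p p)

¬⇒isNo : ∀ {P : Set} (P? : Dec P) → ¬ P → isYes P? ≡ false
¬⇒isNo (yes p) ¬p = ⊥-elim (¬p p)
¬⇒isNo (no _) _ = refl

isYes-cong : ∀ {P Q : Set} (P? : Dec P) (Q? : Dec Q) → (P → Q) → (Q → P) → isYes P? ≡ isYes Q?
isYes-cong (yes _) (yes _) _ _ = refl
isYes-cong (yes p) (no ¬q) f _ = ⊥-elim (¬q (f p))
isYes-cong (no ¬p) (yes q) _ g = ⊥-elim (¬p (g q))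
isYes-cong (no _) (no _) _ _ = refl

-- ShareEnd e f unfolds to Share (src e , tgt e) (src f , tgt f)
Share : {A : Set} → A × A → A × A → Set
Share (s , t) (s′ , t′) = (s ≡ s′) ⊎ (s ≡ t′) ⊎ (t ≡ s′) ⊎ (t ≡ t′)

module _ {A : Set} where

  Share-sym : ∀ {p q : A × A} → Share p q → Share q p
  Share-sym {_ , _} {_ , _} (inj₁ e) = inj₁ (sym e)
  Share-sym {_ , _} {_ , _} (inj₂ (inj₁ e)) = inj₂ (inj₂ (inj₁ (sym e)))
  Share-sym {_ , _} {_ , _} (inj₂ (inj₂ (inj₁ e))) = inj₂ (inj₁ (sym e))
  Share-sym {_ , _} {_ , _} (inj₂ (inj₂ (inj₂ e))) = inj₂ (inj₂ (inj₂ (sym e)))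

  module _ {B : Set} (f : A → B) {s t s′ t′ : A} where

    Share-map : Share (s , t) (s′ , t′) → Share (f s , f t) (f s′ , f t′)
    Share-map (inj₁ e) = inj₁ (cong f e)
    Share-map (inj₂ (inj₁ e)) = inj₂ (inj₁ (cong f e))
    Share-map (inj₂ (inj₂ (inj₁ e))) = inj₂ (inj₂ (inj₁ (cong f e)))
    Share-map (inj₂ (inj₂ (inj₂ e))) = inj₂ (inj₂ (inj₂ (cong f e)))

    Share-map⁻ : (∀ {a b} → f a ≡ f b → a ≡ b) →
      Share (f s , f t) (f s′ , f t′) → Share (s , t) (s′ , t′)
    Share-map⁻ f-inj (inj₁ e) = inj₁ (f-inj e)
    Share-map⁻ f-inj (inj₂ (inj₁ e)) = inj₂ (inj₁ (f-inj e))
    Share-map⁻ f-inj (inj₂ (inj₂ (inj₁ e))) = inj₂ (inj₂ (inj₁ (f-inj e)))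
    Share-map⁻ f-inj (inj₂ (inj₂ (inj₂ e))) = inj₂ (inj₂ (inj₂ (f-inj e)))

module _ {m} {H : FinGraph m} where

  ends : Edge H → ℕ × ℕ
  ends e = toℕ (src {H = H} e) , toℕ (tgt {H = H} e)

  ShareEnd⇒ℕ : ∀ e f → ShareEnd {H = H} e f → Share (ends e) (ends f)
  ShareEnd⇒ℕ _ _ = Share-map toℕ

  ℕ⇒ShareEnd : ∀ e f → Share (ends e) (ends f) → ShareEnd {H = H} e f
  ℕ⇒ShareEnd _ _ = Share-map⁻ toℕ toℕ-injective

  Edge-≡ : ∀ {e f} → ends e ≡ ends f → e ≡ f
  Edge-≡ {u , v , u<v , uv} {u′ , v′ , u′<v′ , u′v′} eq
    with refl ← toℕ-injective {i = u} {j = u′} (cong proj₁ eq)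
       | refl ← toℕ-injective {i = v} {j = v′} (cong proj₂ eq)
    rewrite <-irrelevant u<v u′<v′ | uip uv u′v′ = refl

PathRel : ℕ → ℕ → Set
PathRel a b = suc a ≡ b ⊎ suc b ≡ a

CycleRel : ℕ → ℕ → ℕ → Set
CycleRel L a b = PathRel a b ⊎ (a ≡ 0 × suc b ≡ L) ⊎ (b ≡ 0 × suc a ≡ L)

PathRel? : ∀ a b → Dec (PathRel a b)
PathRel? a b = (suc a ≟ b) ⊎-dec (suc b ≟ a)

CycleRel? : ∀ L a b → Dec (CycleRel L a b)
CycleRel? L a b = PathRel? a b ⊎-dec (((a ≟ 0) ×-dec (suc b ≟ L)) ⊎-dec ((b ≟ 0) ×-dec (suc a ≟ L)))

PathRel-sym : ∀ {a b} → PathRel a b → PathRel b a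
PathRel-sym (inj₁ p) = inj₂ p
PathRel-sym (inj₂ p) = inj₁ p

CycleRel-sym : ∀ {L a b} → CycleRel L a b → CycleRel L b a
CycleRel-sym (inj₁ p) = inj₁ (PathRel-sym p)
CycleRel-sym (inj₂ (inj₁ p)) = inj₂ (inj₂ p)
CycleRel-sym (inj₂ (inj₂ p)) = inj₂ (inj₁ p)

PathRel-irrefl : ∀ {a} → ¬ PathRel a a
PathRel-irrefl (inj₁ ())
PathRel-irrefl (inj₂ ())

-- fewer than three vertices would make the closing pair a loop
CycleRel-irrefl : ∀ {k a} → ¬ CycleRel (3 + k) a a
CycleRel-irrefl (inj₁ p) = PathRel-irrefl p
CycleRel-irrefl (inj₂ (inj₁ (refl , ())))
CycleRel-irrefl (inj₂ (inj₂ (refl , ())))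

Share-suc⇒ : ∀ {a b} → a ≢ b → Share (a , suc a) (b , suc b) → PathRel a b
Share-suc⇒ a≢b (inj₁ p) = ⊥-elim (a≢b p)
Share-suc⇒ a≢b (inj₂ (inj₁ p)) = inj₂ (sym p)
Share-suc⇒ a≢b (inj₂ (inj₂ (inj₁ p))) = inj₁ p
Share-suc⇒ a≢b (inj₂ (inj₂ (inj₂ p))) = ⊥-elim (a≢b (suc-injective p))

Share-suc⇐ : ∀ {a b} → PathRel a b → Share (a , suc a) (b , suc b)
Share-suc⇐ (inj₁ p) = inj₂ (inj₂ (inj₁ p))
Share-suc⇐ (inj₂ p) = inj₂ (inj₁ (sym p))

module RelationGraph (R : ℕ → ℕ → Set) (R? : ∀ a b → Dec (R a b))
  (R-sym : ∀ {a b} → R a b → R b a) (R-irrefl : ∀ {a} → ¬ R a a) where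

  relGraph : ∀ m → FinGraph m
  relGraph m = record
    { adj = λ i j → isYes (R? (toℕ i) (toℕ j))
    ; sym = λ i j → isYes-cong (R? _ _) (R? _ _) R-sym R-sym
    ; irrefl = λ i → ¬⇒isNo (R? _ _) R-irrefl }

  module _ {m} {i j : Fin m} where

    Adj⇒R : Adj (relGraph m) i j → R (toℕ i) (toℕ j)
    Adj⇒R = isYes⇒ (R? _ _)

    R⇒Adj : R (toℕ i) (toℕ j) → Adj (relGraph m) i j
    R⇒Adj = ⇒isYes (R? _ _)

  Edge⇒R : ∀ {m} (e : Edge (relGraph m)) → R (proj₁ (ends {H = relGraph m} e)) (proj₂ (ends {H = relGraph m} e))
  Edge⇒R (u , v , _ , uv) = Adj⇒R {i = u} {j = v} uv

  module Connected (R-suc : ∀ a → R a (suc a)) {ℓ : ℕ} where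

    H = relGraph (suc ℓ)

    sucAdj : ∀ (j : Fin ℓ) → Adj H (inject₁ j) (fsuc j)
    sucAdj j = R⇒Adj (subst (λ a → R a (suc (toℕ j))) (sym (toℕ-inject₁ j)) (R-suc (toℕ j)))

    sucEdge : Fin ℓ → Edge H
    sucEdge j = inject₁ j , fsuc j , s≤s (≤-reflexive (toℕ-inject₁ j)) , sucAdj j

    ends-sucEdge : ∀ j → ends {H = H} (sucEdge j) ≡ (toℕ j , suc (toℕ j))
    ends-sucEdge j = cong (_, suc (toℕ j)) (toℕ-inject₁ j)

    ShareEnd-sucEdge⇒ : ∀ {i j} → i ≢ j → ShareEnd {H = H} (sucEdge i) (sucEdge j) → PathRel (toℕ i) (toℕ j)
    ShareEnd-sucEdge⇒ {i} {j} i≢j sh = Share-suc⇒ (λ p → i≢j (toℕ-injective p))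
      (subst₂ Share (ends-sucEdge i) (ends-sucEdge j) (ShareEnd⇒ℕ {H = H} (sucEdge i) (sucEdge j) sh))

    ShareEnd-sucEdge⇐ : ∀ {i j} → PathRel (toℕ i) (toℕ j) → ShareEnd {H = H} (sucEdge i) (sucEdge j)
    ShareEnd-sucEdge⇐ {i} {j} r =
      ℕ⇒ShareEnd {H = H} (sucEdge i) (sucEdge j)
        (subst₂ Share (sym (ends-sucEdge i)) (sym (ends-sucEdge j)) (Share-suc⇐ r))

    reach-from-0 : ∀ a (u : Fin (suc ℓ)) → toℕ u ≡ a → Reach H fzero u
    reach-from-0 zero fzero _ = ε
    reach-from-0 (suc a) (fsuc u) u≡a =
      reach-from-0 a (inject₁ u) (trans (toℕ-inject₁ u) (suc-injective u≡a)) ◅◅ (sucAdj u ◅ ε)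

    connected : ∀ u v → Reach H u v
    connected u v = Star.reverse (Adj-sym H) (reach-from-0 _ u refl) ◅◅ reach-from-0 _ v refl

    component-iso : ∀ (S : Fin (suc ℓ) → Fin (suc ℓ) → Set) → (∀ i j → S i j ⇔ R (toℕ i) (toℕ j)) →
      ∀ v C → (∀ u → (u ∈ₛ C) ⇔ Reach H v u) → IsoTo (suc ℓ) S (InducedVerts C) (InducedAdj H C)
    component-iso S S⇔R v C C⇔ = mk⤖ {to = to} (cong proj₁ , λ u → proj₁ u , surj u) ,
      λ i j → mk⇔ (λ s → R⇒Adj (Equivalence.to (S⇔R i j) s)) (λ a → Equivalence.from (S⇔R i j) (Adj⇒R a))
      where
      to : Fin (suc ℓ) → InducedVerts C
      to u = u , Equivalence.from (C⇔ u) (connected v u)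
      surj : ∀ u {w} → w ≡ proj₁ u → to w ≡ u
      surj (u , u∈C) refl = cong (u ,_) ([]=-irrelevant _ u∈C)

module PathGraph = RelationGraph PathRel PathRel? PathRel-sym PathRel-irrefl
module CycleGraph (k : ℕ) = RelationGraph (CycleRel (3 + k)) (CycleRel? (3 + k)) CycleRel-sym CycleRel-irrefl

module PathConnected (ℓ : ℕ) = PathGraph.Connected (λ _ → inj₁ refl) {ℓ}
module CycleConnected (k : ℕ) = CycleGraph.Connected k (λ _ → inj₁ (inj₁ refl)) {2 + k}

pathGraph : ∀ ℓ → FinGraph (suc ℓ)
pathGraph ℓ = PathGraph.relGraph (suc ℓ)

cycleGraph : ∀ k → FinGraph (3 + k)
cycleGraph k = CycleGraph.relGraph k (3 + k)

module _ (ℓ : ℕ) where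
  open PathGraph
  open PathConnected ℓ

  pathEdge-index : Edge (pathGraph ℓ) → Fin ℓ
  pathEdge-index (u , v , u<v , _) = fromℕ< (≤-trans u<v (toℕ≤pred[n] v))

  pathEdge-succ : ∀ (e : Edge (pathGraph ℓ)) → proj₂ (ends {H = H} e) ≡ suc (proj₁ (ends {H = H} e))
  pathEdge-succ e@(_ , _ , u<v , _) with Edge⇒R e
  ... | inj₁ p = sym p
  ... | inj₂ p = ⊥-elim (<-asym u<v (≤-reflexive p))

  pathEdges : Fin ℓ ↔ Edge (pathGraph ℓ)
  pathEdges = mk↔ₛ′ sucEdge pathEdge-index
    (λ e → Edge-≡ {H = H} (trans (ends-sucEdge _)
             (cong₂ _,_ (toℕ-fromℕ< _) (trans (cong suc (toℕ-fromℕ< _)) (sym (pathEdge-succ e))))))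
    (λ i → toℕ-injective (trans (toℕ-fromℕ< _) (toℕ-inject₁ i)))

data LastView : ∀ {n} → Fin (suc n) → Set where
  inner : ∀ {n} (j : Fin n) → LastView (inject₁ j)
  last  : ∀ {n} → LastView (fromℕ n)

lastView : ∀ {n} (i : Fin (suc n)) → LastView i
lastView {zero} fzero = last
lastView {suc n} fzero = inner fzero
lastView {suc n} (fsuc i) with lastView i
... | inner j = inner (fsuc j)
... | last = last

lastView-fromℕ : ∀ n → lastView (fromℕ n) ≡ last
lastView-fromℕ zero = refl
lastView-fromℕ (suc n) rewrite lastView-fromℕ n = refl

module _ {k a : ℕ} (a<2+k : a < 2 + k) where

  Share-closing⇒ : Share (a , suc a) (0 , 2 + k) → CycleRel (3 + k) a (2 + k)
  Share-closing⇒ (inj₁ a≡0) = inj₂ (inj₁ (a≡0 , refl))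
  Share-closing⇒ (inj₂ (inj₁ refl)) = ⊥-elim (<-irrefl refl a<2+k)
  Share-closing⇒ (inj₂ (inj₂ (inj₂ p))) = inj₁ (inj₁ p)

  Share-closing⇐ : CycleRel (3 + k) a (2 + k) → Share (a , suc a) (0 , 2 + k)
  Share-closing⇐ (inj₁ (inj₁ p)) = inj₂ (inj₂ (inj₂ p))
  Share-closing⇐ (inj₁ (inj₂ refl)) = ⊥-elim (<-asym a<2+k (≤-reflexive refl))
  Share-closing⇐ (inj₂ (inj₁ (a≡0 , _))) = inj₁ a≡0

CycleRel⇒PathRel : ∀ {k a b} → a < 2 + k → b < 2 + k → CycleRel (3 + k) a b → PathRel a b
CycleRel⇒PathRel _ _ (inj₁ r) = r
CycleRel⇒PathRel _ b< (inj₂ (inj₁ (_ , refl))) = ⊥-elim (<-irrefl refl b<)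
CycleRel⇒PathRel a< _ (inj₂ (inj₂ (_ , refl))) = ⊥-elim (<-irrefl refl a<)

module _ (k : ℕ) where
  open CycleGraph k
  open CycleConnected k

  closingEdge : Edge H
  closingEdge = fzero , fromℕ (2 + k) , subst (0 <_) (sym (toℕ-fromℕ (2 + k))) (s≤s z≤n) ,
                R⇒Adj (inj₂ (inj₁ (refl , cong suc (toℕ-fromℕ (2 + k)))))

  ends-closingEdge : ends {H = H} closingEdge ≡ (0 , 2 + k)
  ends-closingEdge = cong (0 ,_) (toℕ-fromℕ (2 + k))

  cycleEdgeAt : ∀ {i : Fin (3 + k)} → LastView i → Edge H
  cycleEdgeAt (inner j) = sucEdge j
  cycleEdgeAt last = closingEdge

  cycleEdge : Fin (3 + k) → Edge H
  cycleEdge i = cycleEdgeAt (lastView i)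

  IsClosing : Edge H → Set
  IsClosing e = proj₁ (ends {H = H} e) ≡ 0 × proj₂ (ends {H = H} e) ≡ 2 + k

  closing? : ∀ e → Dec (IsClosing e)
  closing? e = (proj₁ (ends {H = H} e) ≟ 0) ×-dec (proj₂ (ends {H = H} e) ≟ 2 + k)

  -- every other edge joins consecutive vertices, and it is indexed by its left endpoint
  cycleEdge-index : Edge H → Fin (3 + k)
  cycleEdge-index e with closing? e
  ... | yes _ = fromℕ (2 + k)
  ... | no _ = src {H = H} e

  nonClosing-succ : ∀ (e : Edge H) → ¬ IsClosing e → proj₂ (ends {H = H} e) ≡ suc (proj₁ (ends {H = H} e))
  nonClosing-succ e@(_ , _ , u<v , _) ¬closing with Edge⇒R e
  ... | inj₁ (inj₁ p) = sym p
  ... | inj₁ (inj₂ p) = ⊥-elim (<-asym u<v (≤-reflexive p))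
  ... | inj₂ (inj₁ (u≡0 , v+1≡L)) = ⊥-elim (¬closing (u≡0 , suc-injective v+1≡L))
  ... | inj₂ (inj₂ (v≡0 , _)) = ⊥-elim (n≮0 (subst (_ <_) v≡0 u<v))

  cycleEdge-index-at : ∀ {i} (v : LastView {2 + k} i) → cycleEdge-index (cycleEdgeAt v) ≡ i
  cycleEdge-index-at (inner j) with closing? (sucEdge j)
  ... | no _ = refl
  ... | yes (j≡0 , j+1≡2+k) with () ← trans (sym (trans (sym (toℕ-inject₁ j)) j≡0)) (suc-injective j+1≡2+k)
  cycleEdge-index-at last with closing? closingEdge
  ... | yes _ = refl
  ... | no ¬closing = ⊥-elim (¬closing (refl , toℕ-fromℕ (2 + k)))

  cycleEdge-cycleEdge-index : ∀ e → cycleEdge (cycleEdge-index e) ≡ e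
  cycleEdge-cycleEdge-index e@(_ , v , u<v , _) with closing? e
  ... | yes (u≡0 , v≡2+k) rewrite lastView-fromℕ (2 + k) =
    Edge-≡ {H = H} (trans ends-closingEdge (sym (cong₂ _,_ u≡0 v≡2+k)))
  ... | no ¬closing = at (lastView (src {H = H} e)) refl
    where
    at : ∀ {i : Fin (3 + k)} (v : LastView i) → i ≡ src {H = H} e → cycleEdgeAt v ≡ e
    at (inner j) refl = Edge-≡ {H = H} (trans (ends-sucEdge j)
      (cong₂ _,_ (sym (toℕ-inject₁ j)) (sym (trans (nonClosing-succ e ¬closing) (cong suc (toℕ-inject₁ j))))))
    at last u≡ = ⊥-elim (1+n≰n (≤-trans
      (subst (λ a → suc a ≤ toℕ v) (trans (cong toℕ (sym u≡)) (toℕ-fromℕ (2 + k))) u<v) (toℕ≤pred[n] v)))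

  cycleEdges : Fin (3 + k) ↔ Edge H
  cycleEdges = mk↔ₛ′ cycleEdge cycleEdge-index cycleEdge-cycleEdge-index (λ i → cycleEdge-index-at (lastView i))

  private
    inner-closing⇒ : ∀ i → ShareEnd {H = H} (sucEdge i) closingEdge →
      CycleRel (3 + k) (toℕ (inject₁ i)) (toℕ (fromℕ (2 + k)))
    inner-closing⇒ i sh = subst₂ (CycleRel (3 + k)) (sym (toℕ-inject₁ i)) (sym (toℕ-fromℕ (2 + k)))
      (Share-closing⇒ (toℕ<n i)
        (subst₂ Share (ends-sucEdge i) ends-closingEdge (ShareEnd⇒ℕ {H = H} (sucEdge i) closingEdge sh)))

    inner-closing⇐ : ∀ i → CycleRel (3 + k) (toℕ (inject₁ i)) (toℕ (fromℕ (2 + k))) →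
      ShareEnd {H = H} (sucEdge i) closingEdge
    inner-closing⇐ i r = ℕ⇒ShareEnd {H = H} (sucEdge i) closingEdge
      (subst₂ Share (sym (ends-sucEdge i)) (sym ends-closingEdge)
        (Share-closing⇐ (toℕ<n i)
          (subst₂ (CycleRel (3 + k)) (toℕ-inject₁ i) (toℕ-fromℕ (2 + k)) r)))

    toℕ-inject₁< : ∀ (i : Fin (2 + k)) → toℕ (inject₁ i) < 2 + k
    toℕ-inject₁< i = subst (_< 2 + k) (sym (toℕ-inject₁ i)) (toℕ<n i)

  ShareEnd-cycleEdge⇒ : ∀ {i j} → i ≢ j → ShareEnd {H = H} (cycleEdge i) (cycleEdge j) →
    CycleRel (3 + k) (toℕ i) (toℕ j)
  ShareEnd-cycleEdge⇒ {i} {j} = at (lastView i) (lastView j)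
    where
    at : ∀ {i j : Fin (3 + k)} (vi : LastView i) (vj : LastView j) → i ≢ j →
      ShareEnd {H = H} (cycleEdgeAt vi) (cycleEdgeAt vj) → CycleRel (3 + k) (toℕ i) (toℕ j)
    at (inner i) (inner j) i≢j sh = inj₁ (subst₂ PathRel (sym (toℕ-inject₁ i)) (sym (toℕ-inject₁ j))
      (ShareEnd-sucEdge⇒ (λ i≡j → i≢j (cong inject₁ i≡j)) sh))
    at (inner i) last _ sh = inner-closing⇒ i sh
    at last (inner j) _ sh = CycleRel-sym (inner-closing⇒ j (Share-sym sh))
    at last last i≢j _ = ⊥-elim (i≢j refl)

  ShareEnd-cycleEdge⇐ : ∀ {i j} → CycleRel (3 + k) (toℕ i) (toℕ j) →
    ShareEnd {H = H} (cycleEdge i) (cycleEdge j)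
  ShareEnd-cycleEdge⇐ {i} {j} = at (lastView i) (lastView j)
    where
    at : ∀ {i j : Fin (3 + k)} (vi : LastView i) (vj : LastView j) →
      CycleRel (3 + k) (toℕ i) (toℕ j) → ShareEnd {H = H} (cycleEdgeAt vi) (cycleEdgeAt vj)
    at (inner i) (inner j) r = ShareEnd-sucEdge⇐ (subst₂ PathRel (toℕ-inject₁ i) (toℕ-inject₁ j)
      (CycleRel⇒PathRel (toℕ-inject₁< i) (toℕ-inject₁< j) r))
    at (inner i) last r = inner-closing⇐ i r
    at last (inner j) r = Share-sym (inner-closing⇐ j (CycleRel-sym r))
    at last last r = ⊥-elim (CycleRel-irrefl r)

parity : ℕ → Bool
parity zero = false
parity (suc n) = not (parity n)

parity-cases : ∀ n → (parity n ≡ false × 2 ∣ n) ⊎ (parity n ≡ true × 2 ∣ suc n)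
parity-cases zero = inj₁ (refl , divides 0 refl)
parity-cases (suc n) with parity-cases n
... | inj₁ (p , divides q refl) = inj₂ (cong not p , divides (suc q) refl)
... | inj₂ (p , 2∣1+n) = inj₁ (cong not p , 2∣1+n)

parity-even : ∀ {n} → 2 ∣ n → parity n ≡ false
parity-even (divides q refl) = even q
  where
  even : ∀ q → parity (q * 2) ≡ false
  even zero = refl
  even (suc q) = trans (not-involutive (parity (q * 2))) (even q)

PathRel-parity : ∀ {a b} → PathRel a b → parity a ≢ parity b
PathRel-parity (inj₁ refl) = not-¬ refl
PathRel-parity (inj₂ refl) = not-¬ refl ∘ sym

CycleRel-parity : ∀ {L a b} → 2 ∣ L → CycleRel L a b → parity a ≢ parity b
CycleRel-parity _ (inj₁ r) = PathRel-parity r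
CycleRel-parity 2∣L (inj₂ (inj₁ (refl , refl))) a≡b = not-¬ a≡b (sym (parity-even 2∣L))
CycleRel-parity 2∣L (inj₂ (inj₂ (refl , refl))) a≡b = not-¬ (sym a≡b) (sym (parity-even 2∣L))

pathGraph-bipartite : ∀ ℓ → IsBipartite (pathGraph ℓ)
pathGraph-bipartite ℓ = parity ∘ toℕ , λ u v uv → PathRel-parity (PathGraph.Adj⇒R {i = u} {j = v} uv)

cycleGraph-bipartite : ∀ k → 2 ∣ 3 + k → IsBipartite (cycleGraph k)
cycleGraph-bipartite k 2∣L = parity ∘ toℕ , λ u v uv → CycleRel-parity 2∣L (CycleGraph.Adj⇒R k {i = u} {j = v} uv)

sucMod⇔ : ∀ {L a b} .{{_ : NonZero L}} → a < L → b < L →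
  (b ≡ suc a % L) ⇔ (suc a ≡ b ⊎ (b ≡ 0 × suc a ≡ L))
sucMod⇔ {L} {a} {b} a<L b<L with m≤n⇒m<n∨m≡n a<L
... | inj₁ 1+a<L = mk⇔ (λ b≡ → inj₁ (sym (trans b≡ (m<n⇒m%n≡m 1+a<L))))
  λ { (inj₁ refl) → sym (m<n⇒m%n≡m 1+a<L) ; (inj₂ (_ , 1+a≡L)) → ⊥-elim (<-irrefl 1+a≡L 1+a<L) }
... | inj₂ refl = mk⇔ (λ b≡ → inj₂ (trans b≡ (n%n≡0 (suc a)) , refl))
  λ { (inj₁ refl) → ⊥-elim (<-irrefl refl b<L) ; (inj₂ (b≡0 , _)) → trans b≡0 (sym (n%n≡0 (suc a))) }

CycleAdj⇔CycleRel : ∀ k (i j : Fin (3 + k)) → CycleAdj (3 + k) i j ⇔ CycleRel (3 + k) (toℕ i) (toℕ j)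
CycleAdj⇔CycleRel k i j = mk⇔ to from
  where
  i→j = sucMod⇔ (toℕ<n i) (toℕ<n j)
  j→i = sucMod⇔ (toℕ<n j) (toℕ<n i)
  to : CycleAdj (3 + k) i j → CycleRel (3 + k) (toℕ i) (toℕ j)
  to (inj₁ j≡) with Equivalence.to i→j j≡
  ... | inj₁ p = inj₁ (inj₁ p)
  ... | inj₂ p = inj₂ (inj₂ p)
  to (inj₂ i≡) with Equivalence.to j→i i≡
  ... | inj₁ p = inj₁ (inj₂ p)
  ... | inj₂ p = inj₂ (inj₁ p)
  from : CycleRel (3 + k) (toℕ i) (toℕ j) → CycleAdj (3 + k) i j
  from (inj₁ (inj₁ p)) = inj₁ (Equivalence.from i→j (inj₁ p))
  from (inj₁ (inj₂ p)) = inj₂ (Equivalence.from j→i (inj₁ p))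
  from (inj₂ (inj₁ p)) = inj₂ (Equivalence.from j→i (inj₂ p))
  from (inj₂ (inj₂ p)) = inj₁ (Equivalence.from i→j (inj₂ p))

pathGraph-components : ∀ ℓ → ComponentsPathsOrEvenCycles (pathGraph ℓ)
pathGraph-components ℓ v C C⇔ =
  inj₁ (suc ℓ , PathConnected.component-iso ℓ (PathAdj (suc ℓ)) (λ _ _ → mk⇔ id id) v C C⇔)

cycleGraph-components : ∀ k → 2 ∣ 3 + k → ComponentsPathsOrEvenCycles (cycleGraph k)
cycleGraph-components k 2∣L v C C⇔ =
  inj₂ (3 + k , s≤s (s≤s (s≤s z≤n)) , 2∣L ,
        CycleConnected.component-iso k (CycleAdj (3 + k)) (CycleAdj⇔CycleRel k) v C C⇔)

-- Disjoint unions

IsoTo-transport : ∀ {k R V W} {A : V → V → Set} {B : W → W → Set} (ψ : V ⤖ W) →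
  (∀ {a b} → A a b → B (Bijection.to ψ a) (Bijection.to ψ b)) →
  (∀ {a b} → B (Bijection.to ψ a) (Bijection.to ψ b) → A a b) →
  IsoTo k R V A → IsoTo k R W B
IsoTo-transport ψ A⇒B B⇒A (φ , φ-adj) =
  ψ ⤖-∘ φ , λ i j → mk⇔ (A⇒B ∘′ Equivalence.to (φ-adj i j)) (Equivalence.from (φ-adj i j) ∘′ B⇒A)

module ClosedEmbedding {m m₁} (H : FinGraph m) (H₁ : FinGraph m₁) (ι : Fin m₁ → Fin m)
  (ι-injective : ∀ {a b} → ι a ≡ ι b → a ≡ b)
  (closed : ∀ a w → Adj H (ι a) w → ∃ λ b → w ≡ ι b)
  (Adj⁺ : ∀ {a b} → Adj H₁ a b → Adj H (ι a) (ι b))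
  (Adj⁻ : ∀ {a b} → Adj H (ι a) (ι b) → Adj H₁ a b) where

  Reach⁻ : ∀ {s u} → Reach H s u → ∀ a → s ≡ ι a → ∃ λ b → u ≡ ι b × Reach H₁ a b
  Reach⁻ ε a s≡ = a , s≡ , ε
  Reach⁻ (su ◅ r) a refl with b , refl ← closed a _ su with c , u≡ , r′ ← Reach⁻ r b refl =
    c , u≡ , (Adj⁻ su ◅ r′)

  Reach⁺ : ∀ {a b} → Reach H₁ a b → Reach H (ι a) (ι b)
  Reach⁺ ε = ε
  Reach⁺ (ab ◅ r) = Adj⁺ ab ◅ Reach⁺ r

  components : ComponentsPathsOrEvenCycles H₁ → ∀ a C → (∀ u → (u ∈ₛ C) ⇔ Reach H (ι a) u) →
    IsPathOrEvenCycle H C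
  components comps a C C⇔ = transfer (comps a C₁ C₁⇔)
    where
    C₁ : Subset m₁
    C₁ = Vec.tabulate (λ b → Vec.lookup C (ι b))
    ∈C₁⇒ : ∀ {b} → b ∈ₛ C₁ → ι b ∈ₛ C
    ∈C₁⇒ {b} b∈ = lookup⇒[]= (ι b) C (trans (sym (lookup∘tabulate _ b)) ([]=⇒lookup b∈))
    ⇒∈C₁ : ∀ {b} → ι b ∈ₛ C → b ∈ₛ C₁
    ⇒∈C₁ {b} ιb∈ = lookup⇒[]= b C₁ (trans (lookup∘tabulate _ b) ([]=⇒lookup ιb∈))
    C₁⇔ : ∀ b → (b ∈ₛ C₁) ⇔ Reach H₁ a b
    C₁⇔ b = mk⇔ (λ b∈ → reach (Reach⁻ (Equivalence.to (C⇔ (ι b)) (∈C₁⇒ b∈)) a refl))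
                (λ r → ⇒∈C₁ (Equivalence.from (C⇔ (ι b)) (Reach⁺ r)))
      where
      reach : (∃ λ c → ι b ≡ ι c × Reach H₁ a c) → Reach H₁ a b
      reach (c , ιb≡ιc , r) rewrite ι-injective ιb≡ιc = r
    ψ : InducedVerts C₁ → InducedVerts C
    ψ (b , b∈) = ι b , ∈C₁⇒ b∈
    ψ-injective : ∀ {x y} → ψ x ≡ ψ y → x ≡ y
    ψ-injective {b , p} {b′ , p′} eq with refl ← ι-injective (cong proj₁ eq) = cong (b ,_) ([]=-irrelevant p p′)
    ψ-surjective : ∀ y → ∃ λ x → ∀ {z} → z ≡ x → ψ z ≡ y
    ψ-surjective (u , u∈) with c , refl , _ ← Reach⁻ (Equivalence.to (C⇔ u) u∈) a refl =
      (c , ⇒∈C₁ u∈) , λ { refl → cong (ι c ,_) ([]=-irrelevant _ u∈) }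
    iso : ∀ {k R} → IsoTo k R (InducedVerts C₁) (InducedAdj H₁ C₁) → IsoTo k R (InducedVerts C) (InducedAdj H C)
    iso = IsoTo-transport {A = InducedAdj H₁ C₁} {B = InducedAdj H C}
            (mk⤖ (ψ-injective , ψ-surjective)) Adj⁺ Adj⁻
    transfer : IsPathOrEvenCycle H₁ C₁ → IsPathOrEvenCycle H C
    transfer (inj₁ (k , I)) = inj₁ (k , iso I)
    transfer (inj₂ (k , k≥3 , 2∣k , I)) = inj₂ (k , k≥3 , 2∣k , iso I)

module DisjointUnion {m₁ m₂} (H₁ : FinGraph m₁) (H₂ : FinGraph m₂) where

  adj⊎ : Fin m₁ ⊎ Fin m₂ → Fin m₁ ⊎ Fin m₂ → Bool
  adj⊎ (inj₁ a) (inj₁ b) = adj H₁ a b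
  adj⊎ (inj₂ a) (inj₂ b) = adj H₂ a b
  adj⊎ (inj₁ _) (inj₂ _) = false
  adj⊎ (inj₂ _) (inj₁ _) = false

  adj⊎-sym : ∀ x y → adj⊎ x y ≡ adj⊎ y x
  adj⊎-sym (inj₁ a) (inj₁ b) = FinGraph.sym H₁ a b
  adj⊎-sym (inj₂ a) (inj₂ b) = FinGraph.sym H₂ a b
  adj⊎-sym (inj₁ _) (inj₂ _) = refl
  adj⊎-sym (inj₂ _) (inj₁ _) = refl

  adj⊎-irrefl : ∀ x → adj⊎ x x ≡ false
  adj⊎-irrefl (inj₁ a) = irrefl H₁ a
  adj⊎-irrefl (inj₂ a) = irrefl H₂ a

  H : FinGraph (m₁ + m₂)
  H = record
    { adj = λ p q → adj⊎ (splitAt m₁ p) (splitAt m₁ q)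
    ; sym = λ p q → adj⊎-sym (splitAt m₁ p) (splitAt m₁ q)
    ; irrefl = λ p → adj⊎-irrefl (splitAt m₁ p) }

  ι₁ : Fin m₁ → Fin (m₁ + m₂)
  ι₁ a = a ↑ˡ m₂

  ι₂ : Fin m₂ → Fin (m₁ + m₂)
  ι₂ b = m₁ ↑ʳ b

  ι₁≢ι₂ : ∀ {a b} → ι₁ a ≢ ι₂ b
  ι₁≢ι₂ {a} {b} eq
    with () ← trans (sym (splitAt-↑ˡ m₁ a m₂)) (trans (cong (splitAt m₁) eq) (splitAt-↑ʳ m₁ m₂ b))

  module _ {a b : Fin m₁} where
    Adj-ι₁⁺ : Adj H₁ a b → Adj H (ι₁ a) (ι₁ b)
    Adj-ι₁⁺ ab rewrite splitAt-↑ˡ m₁ a m₂ | splitAt-↑ˡ m₁ b m₂ = ab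
    Adj-ι₁⁻ : Adj H (ι₁ a) (ι₁ b) → Adj H₁ a b
    Adj-ι₁⁻ ab rewrite splitAt-↑ˡ m₁ a m₂ | splitAt-↑ˡ m₁ b m₂ = ab

  module _ {a b : Fin m₂} where
    Adj-ι₂⁺ : Adj H₂ a b → Adj H (ι₂ a) (ι₂ b)
    Adj-ι₂⁺ ab rewrite splitAt-↑ʳ m₁ m₂ a | splitAt-↑ʳ m₁ m₂ b = ab
    Adj-ι₂⁻ : Adj H (ι₂ a) (ι₂ b) → Adj H₂ a b
    Adj-ι₂⁻ ab rewrite splitAt-↑ʳ m₁ m₂ a | splitAt-↑ʳ m₁ m₂ b = ab

  Adj-view : ∀ {p q} → Adj H p q →
    (∃₂ λ a b → p ≡ ι₁ a × q ≡ ι₁ b) ⊎ (∃₂ λ a b → p ≡ ι₂ a × q ≡ ι₂ b)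
  Adj-view {p} {q} pq with splitAt m₁ p in ep | splitAt m₁ q in eq
  ... | inj₁ a | inj₁ b = inj₁ (a , b , sym (splitAt⁻¹-↑ˡ ep) , sym (splitAt⁻¹-↑ˡ eq))
  ... | inj₂ a | inj₂ b = inj₂ (a , b , sym (splitAt⁻¹-↑ʳ ep) , sym (splitAt⁻¹-↑ʳ eq))

  closed₁ : ∀ a w → Adj H (ι₁ a) w → ∃ λ b → w ≡ ι₁ b
  closed₁ a w aw with Adj-view aw
  ... | inj₁ (_ , b , _ , w≡) = b , w≡
  ... | inj₂ (_ , _ , ι₁a≡ , _) = ⊥-elim (ι₁≢ι₂ ι₁a≡)

  closed₂ : ∀ a w → Adj H (ι₂ a) w → ∃ λ b → w ≡ ι₂ b
  closed₂ a w aw with Adj-view aw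
  ... | inj₂ (_ , b , _ , w≡) = b , w≡
  ... | inj₁ (_ , _ , ι₂a≡ , _) = ⊥-elim (ι₁≢ι₂ (sym ι₂a≡))

  bipartite : IsBipartite H₁ → IsBipartite H₂ → IsBipartite H
  bipartite (side₁ , ok₁) (side₂ , ok₂) = side , ok
    where
    side : Fin (m₁ + m₂) → Bool
    side p = Sum.[ side₁ , side₂ ] (splitAt m₁ p)
    ok : ∀ u v → Adj H u v → side u ≢ side v
    ok u v uv with Adj-view uv
    ... | inj₁ (a , b , refl , refl) rewrite splitAt-↑ˡ m₁ a m₂ | splitAt-↑ˡ m₁ b m₂ = ok₁ a b uv
    ... | inj₂ (a , b , refl , refl) rewrite splitAt-↑ʳ m₁ m₂ a | splitAt-↑ʳ m₁ m₂ b = ok₂ a b uv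

  components : ComponentsPathsOrEvenCycles H₁ → ComponentsPathsOrEvenCycles H₂ →
    ComponentsPathsOrEvenCycles H
  components comps₁ comps₂ v C C⇔ with splitAt m₁ v in ev
  ... | inj₁ a =
    ClosedEmbedding.components H H₁ ι₁ (↑ˡ-injective m₂ _ _) closed₁ Adj-ι₁⁺ Adj-ι₁⁻ comps₁ a C
      (λ u → subst (λ w → (u ∈ₛ C) ⇔ Reach H w u) (sym (splitAt⁻¹-↑ˡ ev)) (C⇔ u))
  ... | inj₂ a =
    ClosedEmbedding.components H H₂ ι₂ (↑ʳ-injective m₁ _ _) closed₂ Adj-ι₂⁺ Adj-ι₂⁻ comps₂ a C
      (λ u → subst (λ w → (u ∈ₛ C) ⇔ Reach H w u) (sym (splitAt⁻¹-↑ʳ ev)) (C⇔ u))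

  inj₁E : Edge H₁ → Edge H
  inj₁E (u , v , u<v , uv) =
    ι₁ u , ι₁ v , subst₂ _<_ (sym (toℕ-↑ˡ u m₂)) (sym (toℕ-↑ˡ v m₂)) u<v , Adj-ι₁⁺ uv

  inj₂E : Edge H₂ → Edge H
  inj₂E (u , v , u<v , uv) =
    ι₂ u , ι₂ v , subst₂ _<_ (sym (toℕ-↑ʳ m₁ u)) (sym (toℕ-↑ʳ m₁ v)) (+-monoʳ-< m₁ u<v) ,
    Adj-ι₂⁺ uv

  private
    split : ∀ (e : Edge H) s → splitAt m₁ (src {H = H} e) ≡ s → ∀ t → splitAt m₁ (tgt {H = H} e) ≡ t →
      Edge H₁ ⊎ Edge H₂
    split (_ , _ , p<q , pq) (inj₁ a) ep (inj₁ b) eq =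
      inj₁ (a , b , subst₂ _<_ (trans (cong toℕ (sym (splitAt⁻¹-↑ˡ ep))) (toℕ-↑ˡ a m₂))
                               (trans (cong toℕ (sym (splitAt⁻¹-↑ˡ eq))) (toℕ-↑ˡ b m₂)) p<q ,
            Adj-ι₁⁻ (subst₂ (Adj H) (sym (splitAt⁻¹-↑ˡ ep)) (sym (splitAt⁻¹-↑ˡ eq)) pq))
    split (_ , _ , p<q , pq) (inj₂ a) ep (inj₂ b) eq =
      inj₂ (a , b , +-cancelˡ-< m₁ _ _ (subst₂ _<_ (trans (cong toℕ (sym (splitAt⁻¹-↑ʳ ep))) (toℕ-↑ʳ m₁ a))
                                                    (trans (cong toℕ (sym (splitAt⁻¹-↑ʳ eq))) (toℕ-↑ʳ m₁ b)) p<q) ,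
            Adj-ι₂⁻ (subst₂ (Adj H) (sym (splitAt⁻¹-↑ʳ ep)) (sym (splitAt⁻¹-↑ʳ eq)) pq))
    split (_ , _ , _ , pq) (inj₁ _) ep (inj₂ _) eq with () ← trans (sym pq) (cong₂ adj⊎ ep eq)
    split (_ , _ , _ , pq) (inj₂ _) ep (inj₁ _) eq with () ← trans (sym pq) (cong₂ adj⊎ ep eq)

  edge⁻ : Edge H → Edge H₁ ⊎ Edge H₂
  edge⁻ e = split e _ refl _ refl

  private
    split-inverse : ∀ e s es t et → Sum.[ inj₁E , inj₂E ] (split e s es t et) ≡ e
    split-inverse e (inj₁ a) es (inj₁ b) et =
      Edge-≡ {H = H} (cong₂ _,_ (cong toℕ (splitAt⁻¹-↑ˡ es)) (cong toℕ (splitAt⁻¹-↑ˡ et)))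
    split-inverse e (inj₂ a) es (inj₂ b) et =
      Edge-≡ {H = H} (cong₂ _,_ (cong toℕ (splitAt⁻¹-↑ʳ es)) (cong toℕ (splitAt⁻¹-↑ʳ et)))
    split-inverse (_ , _ , _ , pq) (inj₁ _) es (inj₂ _) et with () ← trans (sym pq) (cong₂ adj⊎ es et)
    split-inverse (_ , _ , _ , pq) (inj₂ _) es (inj₁ _) et with () ← trans (sym pq) (cong₂ adj⊎ es et)

    split-inj₁E : ∀ e s es t et → split (inj₁E e) s es t et ≡ inj₁ e
    split-inj₁E (u , v , _) (inj₁ a) es (inj₁ b) et = cong inj₁ (Edge-≡ {H = H₁} (cong₂ _,_
      (cong toℕ (inj₁-injective (trans (sym es) (splitAt-↑ˡ m₁ u m₂))))
      (cong toℕ (inj₁-injective (trans (sym et) (splitAt-↑ˡ m₁ v m₂))))))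
    split-inj₁E (u , _) (inj₂ _) es _ _ with () ← trans (sym es) (splitAt-↑ˡ m₁ u m₂)
    split-inj₁E (_ , v , _) (inj₁ _) _ (inj₂ _) et with () ← trans (sym et) (splitAt-↑ˡ m₁ v m₂)

    split-inj₂E : ∀ e s es t et → split (inj₂E e) s es t et ≡ inj₂ e
    split-inj₂E (u , v , _) (inj₂ a) es (inj₂ b) et = cong inj₂ (Edge-≡ {H = H₂} (cong₂ _,_
      (cong toℕ (inj₂-injective (trans (sym es) (splitAt-↑ʳ m₁ m₂ u))))
      (cong toℕ (inj₂-injective (trans (sym et) (splitAt-↑ʳ m₁ m₂ v))))))
    split-inj₂E (u , _) (inj₁ _) es _ _ with () ← trans (sym es) (splitAt-↑ʳ m₁ m₂ u)
    split-inj₂E (_ , v , _) (inj₂ _) _ (inj₁ _) et with () ← trans (sym et) (splitAt-↑ʳ m₁ m₂ v)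

  edges : (Edge H₁ ⊎ Edge H₂) ↔ Edge H
  edges = mk↔ₛ′ Sum.[ inj₁E , inj₂E ] edge⁻ (λ e → split-inverse e _ refl _ refl)
    λ { (inj₁ e) → split-inj₁E e _ refl _ refl ; (inj₂ e) → split-inj₂E e _ refl _ refl }

  module _ (e f : Edge H₁) where
    ShareEnd-inj₁E⁺ : ShareEnd {H = H₁} e f → ShareEnd {H = H} (inj₁E e) (inj₁E f)
    ShareEnd-inj₁E⁺ = Share-map ι₁
    ShareEnd-inj₁E⁻ : ShareEnd {H = H} (inj₁E e) (inj₁E f) → ShareEnd {H = H₁} e f
    ShareEnd-inj₁E⁻ = Share-map⁻ ι₁ (↑ˡ-injective m₂ _ _)

  module _ (e f : Edge H₂) where
    ShareEnd-inj₂E⁺ : ShareEnd {H = H₂} e f → ShareEnd {H = H} (inj₂E e) (inj₂E f)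
    ShareEnd-inj₂E⁺ = Share-map ι₂
    ShareEnd-inj₂E⁻ : ShareEnd {H = H} (inj₂E e) (inj₂E f) → ShareEnd {H = H₂} e f
    ShareEnd-inj₂E⁻ = Share-map⁻ ι₂ (↑ʳ-injective m₁ _ _)

  ¬ShareEnd-inj₁E-inj₂E : ∀ e f → ¬ ShareEnd {H = H} (inj₁E e) (inj₂E f)
  ¬ShareEnd-inj₁E-inj₂E _ _ (inj₁ eq) = ι₁≢ι₂ eq
  ¬ShareEnd-inj₁E-inj₂E _ _ (inj₂ (inj₁ eq)) = ι₁≢ι₂ eq
  ¬ShareEnd-inj₁E-inj₂E _ _ (inj₂ (inj₂ (inj₁ eq))) = ι₁≢ι₂ eq
  ¬ShareEnd-inj₁E-inj₂E _ _ (inj₂ (inj₂ (inj₂ eq))) = ι₁≢ι₂ eq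

-- The line graph of a decomposition

module _ {A : Set} {xs : List A} (u : Unique xs) where

  Neighbours⇒PathRel : ∀ i j → Neighbours xs (lookup xs i) (lookup xs j) → PathRel (toℕ i) (toℕ j)
  Neighbours⇒PathRel i j (inj₁ c) with i′ , j′ , i′≡ , j′≡ , r ← Consecutive-positions c
    rewrite lookup-injective u i′ i i′≡ | lookup-injective u j′ j j′≡ = inj₁ r
  Neighbours⇒PathRel i j (inj₂ c) with j′ , i′ , j′≡ , i′≡ , r ← Consecutive-positions c
    rewrite lookup-injective u i′ i i′≡ | lookup-injective u j′ j j′≡ = inj₂ r

  CyclicNeighbours⇒CycleRel : ∀ i j → CyclicNeighbours xs (lookup xs i) (lookup xs j) →
    CycleRel (length xs) (toℕ i) (toℕ j)
  CyclicNeighbours⇒CycleRel i j (inj₁ nb) = inj₁ (Neighbours⇒PathRel i j nb)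
  CyclicNeighbours⇒CycleRel i j (inj₂ (inj₁ (l , h)))
    with i′ , i′≡ , i′+1≡len ← Last-position l | j′ , j′≡ , j′≡0 ← Head-position h
    rewrite lookup-injective u i′ i i′≡ | lookup-injective u j′ j j′≡ = inj₂ (inj₂ (j′≡0 , i′+1≡len))
  CyclicNeighbours⇒CycleRel i j (inj₂ (inj₂ (l , h)))
    with j′ , j′≡ , j′+1≡len ← Last-position l | i′ , i′≡ , i′≡0 ← Head-position h
    rewrite lookup-injective u i′ i i′≡ | lookup-injective u j′ j j′≡ = inj₂ (inj₁ (i′≡0 , j′+1≡len))

module _ {A : Set} (xs : List A) where

  PathRel⇒Neighbours : ∀ i j → PathRel (toℕ i) (toℕ j) → Neighbours xs (lookup xs i) (lookup xs j)
  PathRel⇒Neighbours i j (inj₁ r) = inj₁ (Consecutive-lookup xs i j r)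
  PathRel⇒Neighbours i j (inj₂ r) = inj₂ (Consecutive-lookup xs j i r)

  CycleRel⇒CyclicNeighbours : ∀ i j → CycleRel (length xs) (toℕ i) (toℕ j) →
    CyclicNeighbours xs (lookup xs i) (lookup xs j)
  CycleRel⇒CyclicNeighbours i j (inj₁ r) = inj₁ (PathRel⇒Neighbours i j r)
  CycleRel⇒CyclicNeighbours i j (inj₂ (inj₁ (i≡0 , j+1≡len))) =
    inj₂ (inj₂ (Last-lookup xs j j+1≡len , Head-lookup xs i i≡0))
  CycleRel⇒CyclicNeighbours i j (inj₂ (inj₂ (j≡0 , i+1≡len))) =
    inj₂ (inj₁ (Last-lookup xs i i+1≡len , Head-lookup xs j j≡0))

module PieceGraphs {n} (D : FinGraph n) (degree≤2 : MaxDegree≤2 D) where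
  open PathCycleDecomposition D degree≤2

  -- a path with ℓ vertices of D is the line graph of a path with ℓ + 1 vertices, a cycle of itself
  size : Piece → ℕ
  size (path xs) = suc (length xs)
  size (cycle _ _ _ xs) = 3 + length xs

  graphOf : ∀ p → FinGraph (size p)
  graphOf (path xs) = pathGraph (length xs)
  graphOf (cycle _ _ _ xs) = cycleGraph (length xs)

  edgesOf : ∀ p → Fin (length (vertices p)) ↔ Edge (graphOf p)
  edgesOf (path xs) = pathEdges (length xs)
  edgesOf (cycle _ _ _ xs) = cycleEdges (length xs)

  pieceEdge : ∀ p → Fin (length (vertices p)) → Edge (graphOf p)
  pieceEdge p = Inverse.to (edgesOf p)

  ShareEnd⇒Linked : ∀ p → Unique (vertices p) → ∀ {i j} → i ≢ j →
    ShareEnd {H = graphOf p} (pieceEdge p i) (pieceEdge p j) →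
    Linked p (lookup (vertices p) i) (lookup (vertices p) j)
  ShareEnd⇒Linked (path xs) u {i} {j} i≢j sh =
    PathRel⇒Neighbours xs i j (PathConnected.ShareEnd-sucEdge⇒ (length xs) {i} {j} i≢j sh)
  ShareEnd⇒Linked (cycle _ _ _ xs) u {i} {j} i≢j sh =
    CycleRel⇒CyclicNeighbours _ i j (ShareEnd-cycleEdge⇒ (length xs) {i} {j} i≢j sh)

  Linked⇒ShareEnd : ∀ p → Unique (vertices p) → ∀ {i j} →
    Linked p (lookup (vertices p) i) (lookup (vertices p) j) →
    ShareEnd {H = graphOf p} (pieceEdge p i) (pieceEdge p j)
  Linked⇒ShareEnd (path xs) u {i} {j} l =
    PathConnected.ShareEnd-sucEdge⇐ (length xs) {i} {j} (Neighbours⇒PathRel u i j l)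
  Linked⇒ShareEnd (cycle _ _ _ xs) u {i} {j} l =
    ShareEnd-cycleEdge⇐ (length xs) {i} {j} (CyclicNeighbours⇒CycleRel u i j l)

  emptyGraph : FinGraph 0
  emptyGraph = record { adj = λ () ; sym = λ () ; irrefl = λ () }

  Position : List Piece → Set
  Position [] = ⊥
  Position (p ∷ Ps) = Fin (length (vertices p)) ⊎ Position Ps

  label : ∀ Ps → Position Ps → Fin n
  label (p ∷ _) (inj₁ i) = lookup (vertices p) i
  label (_ ∷ Ps) (inj₂ P) = label Ps P

  totalSize : List Piece → ℕ
  totalSize [] = 0
  totalSize (p ∷ Ps) = size p + totalSize Ps

  graph : ∀ Ps → FinGraph (totalSize Ps)
  graph [] = emptyGraph
  graph (p ∷ Ps) = DisjointUnion.H (graphOf p) (graph Ps)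

  edges : ∀ Ps → Position Ps ↔ Edge (graph Ps)
  edges [] = mk↔ₛ′ (λ ()) (λ { (() , _) }) (λ { (() , _) }) (λ ())
  edges (p ∷ Ps) = DisjointUnion.edges (graphOf p) (graph Ps) ↔-∘ (edgesOf p ⊎-↔ edges Ps)

  edge : ∀ Ps → Position Ps → Edge (graph Ps)
  edge Ps = Inverse.to (edges Ps)

  label-∈ : ∀ Ps P → label Ps P ∈ allVertices Ps
  label-∈ (p ∷ _) (inj₁ i) = ∈-++⁺ˡ (∈-lookup {xs = vertices p} i)
  label-∈ (p ∷ Ps) (inj₂ P) = ∈-++⁺ʳ (vertices p) (label-∈ Ps P)

  position : ∀ Ps {x} → x ∈ allVertices Ps → ∃ λ P → label Ps P ≡ x
  position (p ∷ Ps) x∈ with ∈-++⁻ (vertices p) x∈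
  ... | inj₁ x∈p = inj₁ (index x∈p) , sym (lookup-index x∈p)
  ... | inj₂ x∈Ps with P , P≡ ← position Ps x∈Ps = inj₂ P , P≡

  label-injective : ∀ Ps → Unique (allVertices Ps) → ∀ P Q → label Ps P ≡ label Ps Q → P ≡ Q
  label-injective (p ∷ _) u (inj₁ i) (inj₁ j) eq =
    cong inj₁ (lookup-injective (Unique-++⁻ˡ (vertices p) u) i j eq)
  label-injective (p ∷ Ps) u (inj₁ i) (inj₂ Q) eq =
    ⊥-elim (Unique-++-disjoint (vertices p) u (∈-lookup {xs = vertices p} i) (label-∈ Ps Q) eq)
  label-injective (p ∷ Ps) u (inj₂ P) (inj₁ j) eq =
    ⊥-elim (Unique-++-disjoint (vertices p) u (∈-lookup {xs = vertices p} j) (label-∈ Ps P) (sym eq))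
  label-injective (p ∷ Ps) u (inj₂ P) (inj₂ Q) eq =
    cong inj₂ (label-injective Ps (Unique-++⁻ʳ (vertices p) u) P Q eq)

  ShareEnd⇒LinkedIn : ∀ Ps → Unique (allVertices Ps) → ∀ P Q → P ≢ Q →
    ShareEnd {H = graph Ps} (edge Ps P) (edge Ps Q) → LinkedIn Ps (label Ps P) (label Ps Q)
  ShareEnd⇒LinkedIn (p ∷ Ps) u = sharing
    where
    open DisjointUnion (graphOf p) (graph Ps)
    sharing : ∀ P Q → P ≢ Q → ShareEnd {H = graph (p ∷ Ps)} (edge (p ∷ Ps) P) (edge (p ∷ Ps) Q) →
      LinkedIn (p ∷ Ps) (label (p ∷ Ps) P) (label (p ∷ Ps) Q)
    sharing (inj₁ i) (inj₁ j) i≢j sh =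
      here (ShareEnd⇒Linked p (Unique-++⁻ˡ (vertices p) u) (i≢j ∘ cong inj₁)
        (ShareEnd-inj₁E⁻ (pieceEdge p i) (pieceEdge p j) sh))
    sharing (inj₂ P) (inj₂ Q) P≢Q sh =
      there (ShareEnd⇒LinkedIn Ps (Unique-++⁻ʳ (vertices p) u) P Q (P≢Q ∘ cong inj₂)
        (ShareEnd-inj₂E⁻ (edge Ps P) (edge Ps Q) sh))
    sharing (inj₁ i) (inj₂ Q) _ sh = ⊥-elim (¬ShareEnd-inj₁E-inj₂E (pieceEdge p i) (edge Ps Q) sh)
    sharing (inj₂ P) (inj₁ j) _ sh = ⊥-elim (¬ShareEnd-inj₁E-inj₂E (pieceEdge p j) (edge Ps P) (Share-sym sh))

  LinkedIn⇒ShareEnd : ∀ Ps → Unique (allVertices Ps) → ∀ P Q →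
    LinkedIn Ps (label Ps P) (label Ps Q) → ShareEnd {H = graph Ps} (edge Ps P) (edge Ps Q)
  LinkedIn⇒ShareEnd (p ∷ Ps) u = linked
    where
    open DisjointUnion (graphOf p) (graph Ps)
    -- a link never leaves the piece containing its ends
    clash : ∀ {a} → a ∈ vertices p → a ∈ allVertices Ps → ⊥
    clash a∈p a∈Ps = Unique-++-disjoint (vertices p) u a∈p a∈Ps refl
    linked : ∀ P Q → LinkedIn (p ∷ Ps) (label (p ∷ Ps) P) (label (p ∷ Ps) Q) →
      ShareEnd {H = graph (p ∷ Ps)} (edge (p ∷ Ps) P) (edge (p ∷ Ps) Q)
    linked (inj₁ i) (inj₁ j) (here l) =
      ShareEnd-inj₁E⁺ (pieceEdge p i) (pieceEdge p j) (Linked⇒ShareEnd p (Unique-++⁻ˡ (vertices p) u) l)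
    linked (inj₂ P) (inj₂ Q) (there l) =
      ShareEnd-inj₂E⁺ (edge Ps P) (edge Ps Q) (LinkedIn⇒ShareEnd Ps (Unique-++⁻ʳ (vertices p) u) P Q l)
    linked (inj₁ i) _ (there l) = ⊥-elim (clash (∈-lookup {xs = vertices p} i) (LinkedIn-∈ Ps (LinkedIn-sym Ps l)))
    linked (inj₂ P) _ (here l) = ⊥-elim (clash (Linked-∈ p (Linked-sym p l)) (label-∈ Ps P))
    linked (inj₁ _) (inj₂ Q) (here l) = ⊥-elim (clash (Linked-∈ p l) (label-∈ Ps Q))
    linked (inj₂ _) (inj₁ j) (there l) = ⊥-elim (clash (∈-lookup {xs = vertices p} j) (LinkedIn-∈ Ps l))

  module _ (colour : Fin n → Bool) where

    Alternating : Piece → Set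
    Alternating p = ∀ {a w} → Linked p a w → colour a ≢ colour w

    private
      last-colour : ∀ {y ys l} → (∀ {a w} → Consecutive (y ∷ ys) a w → colour a ≢ colour w) →
        Last (y ∷ ys) l → colour l ≡ parity (length ys) xor colour y
      last-colour {ys = []} _ here = refl
      last-colour {y} {y′ ∷ ys} alt (there l) = trans (last-colour (alt ∘ there) l) (step (parity (length ys)))
        where
        y′≡ : colour y′ ≡ not (colour y)
        y′≡ = ¬-not (≢-sym (alt here))
        step : ∀ b → b xor colour y′ ≡ not b xor colour y
        step false = y′≡
        step true = trans (cong not y′≡) (not-involutive (colour y))

    cycle-even : ∀ x y z xs → Alternating (cycle x y z xs) → 2 ∣ 3 + length xs
    cycle-even x y z xs alt with Last-exists x (y ∷ z ∷ xs)
    ... | l , l-last with parity-cases (length (y ∷ z ∷ xs))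
    ...   | inj₂ (_ , 2∣) = 2∣
    ...   | inj₁ (even , _) = ⊥-elim (alt (inj₂ (inj₁ (l-last , _ , refl)))
            (trans (last-colour (λ c → alt (inj₁ (inj₁ c))) l-last) (cong (_xor colour x) even)))

    bipartiteOf : ∀ p → Alternating p → IsBipartite (graphOf p)
    bipartiteOf (path xs) _ = pathGraph-bipartite (length xs)
    bipartiteOf (cycle x y z xs) alt = cycleGraph-bipartite (length xs) (cycle-even x y z xs alt)

    componentsOf : ∀ p → Alternating p → ComponentsPathsOrEvenCycles (graphOf p)
    componentsOf (path xs) _ = pathGraph-components (length xs)
    componentsOf (cycle x y z xs) alt = cycleGraph-components (length xs) (cycle-even x y z xs alt)

    graph-bipartite : ∀ Ps → (∀ {a w} → LinkedIn Ps a w → colour a ≢ colour w) → IsBipartite (graph Ps)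
    graph-bipartite [] _ = (λ ()) , λ ()
    graph-bipartite (p ∷ Ps) alt =
      DisjointUnion.bipartite _ _ (bipartiteOf p (alt ∘ here)) (graph-bipartite Ps (alt ∘ there))

    graph-components : ∀ Ps → (∀ {a w} → LinkedIn Ps a w → colour a ≢ colour w) →
      ComponentsPathsOrEvenCycles (graph Ps)
    graph-components [] _ = λ ()
    graph-components (p ∷ Ps) alt =
      DisjointUnion.components _ _ (componentsOf p (alt ∘ here)) (graph-components Ps (alt ∘ there))

-- The three conditions

module CrossGraph {n} (G : FinGraph n) (colour : Fin n → Bool) where

  Bichromatic : Fin n → Fin n → Set
  Bichromatic x y = Adj G x y × colour x ≢ colour y

  bichromatic? : ∀ x y → Dec (Bichromatic x y)
  bichromatic? x y = (adj G x y ≟ᵇ true) ×-dec ¬? (colour x ≟ᵇ colour y)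

  Bichromatic-sym : ∀ {x y} → Bichromatic x y → Bichromatic y x
  Bichromatic-sym (xy , c≢) = Adj-sym G xy , ≢-sym c≢

  crossGraph : FinGraph n
  crossGraph = record
    { adj = λ x y → isYes (bichromatic? x y)
    ; sym = λ x y → isYes-cong (bichromatic? x y) (bichromatic? y x) Bichromatic-sym Bichromatic-sym
    ; irrefl = λ x → ¬⇒isNo (bichromatic? x x) (Adj-irrefl G ∘ proj₁) }

  module _ {x y : Fin n} where
    Adj-cross⁻ : Adj crossGraph x y → Bichromatic x y
    Adj-cross⁻ = isYes⇒ (bichromatic? x y)

    Adj-cross⁺ : Bichromatic x y → Adj crossGraph x y
    Adj-cross⁺ = ⇒isYes (bichromatic? x y)

bitOf : Bool → Fin 2
bitOf false = fzero
bitOf true = fsuc fzero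

bitOf-injective : ∀ {a b} → bitOf a ≡ bitOf b → a ≡ b
bitOf-injective {false} {false} _ = refl
bitOf-injective {true} {true} _ = refl

module LineGraphRealisation {n} (G : FinGraph n) (colour : Fin n → Bool)
  (clique : ∀ {x y} → colour x ≡ colour y → x ≢ y → Adj G x y)
  (degree≤2 : MaxDegree≤2 (CrossGraph.crossGraph G colour)) where

  open CrossGraph G colour
  open PathCycleDecomposition crossGraph degree≤2
  open PieceGraphs crossGraph degree≤2

  Ps : List Piece
  Ps = proj₁ decomposition

  open Decomposition (proj₂ decomposition)

  H : FinGraph (totalSize Ps)
  H = graph Ps

  positionOf : Fin n → Position Ps
  positionOf x = proj₁ (position Ps (covers (toℕ<n x)))

  label-positionOf : ∀ x → label Ps (positionOf x) ≡ x
  label-positionOf x = proj₂ (position Ps (covers (toℕ<n x)))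

  vertexEdges : Fin n ↔ Edge H
  vertexEdges = edges Ps ↔-∘ mk↔ₛ′ positionOf (label Ps)
    (λ P → label-injective Ps unique _ P (label-positionOf (label Ps P))) label-positionOf

  vertexEdge : Fin n → Edge H
  vertexEdge = Inverse.to vertexEdges

  φ : EdgeColouring H
  φ = bitOf ∘ colour ∘ label Ps ∘ Inverse.from (edges Ps)

  φ-vertexEdge : ∀ x → φ (vertexEdge x) ≡ bitOf (colour x)
  φ-vertexEdge x = cong (bitOf ∘ colour) (trans (cong (label Ps) (Inverse.strictlyInverseʳ (edges Ps) (positionOf x)))
                                                 (label-positionOf x))

  bichromatic-links : ∀ {x y} → LinkedIn Ps x y → colour x ≢ colour y
  bichromatic-links = proj₂ ∘ Adj-cross⁻ ∘ sound

  proper : Proper {H = H} φ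
  proper e f e≢f sh φe≡φf = bichromatic-links linked (bitOf-injective φe≡φf)
    where
    P = Inverse.from (edges Ps) e
    Q = Inverse.from (edges Ps) f
    toP = Inverse.strictlyInverseˡ (edges Ps) e
    toQ = Inverse.strictlyInverseˡ (edges Ps) f
    linked = ShareEnd⇒LinkedIn Ps unique P Q (λ P≡Q → e≢f (trans (sym toP) (trans (cong (edge Ps) P≡Q) toQ)))
               (subst₂ (ShareEnd {H = H}) (sym toP) (sym toQ) sh)

  linkedIn⇔ : ∀ x y → LinkedIn Ps x y ⇔ LinkedIn Ps (label Ps (positionOf x)) (label Ps (positionOf y))
  linkedIn⇔ x y = mk⇔ (subst₂ (LinkedIn Ps) (sym (label-positionOf x)) (sym (label-positionOf y)))
                      (subst₂ (LinkedIn Ps) (label-positionOf x) (label-positionOf y))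

  vertexEdge-injective : ∀ {x y} → vertexEdge x ≡ vertexEdge y → x ≡ y
  vertexEdge-injective = Bijection.injective (↔⇒⤖ vertexEdges)

  Adj⇒CLAdj : ∀ x y → Adj G x y → CLAdj {H = H} φ (vertexEdge x) (vertexEdge y)
  Adj⇒CLAdj x y xy = distinct , share-or-same (colour x ≟ᵇ colour y)
    where
    distinct : vertexEdge x ≢ vertexEdge y
    distinct eq = Adj-irrefl G (subst (Adj G x) (sym (vertexEdge-injective eq)) xy)
    share-or-same : Dec (colour x ≡ colour y) →
      ShareEnd {H = H} (vertexEdge x) (vertexEdge y) ⊎ φ (vertexEdge x) ≡ φ (vertexEdge y)
    share-or-same (yes c≡) = inj₂ (trans (φ-vertexEdge x) (trans (cong bitOf c≡) (sym (φ-vertexEdge y))))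
    share-or-same (no c≢) = inj₁ (LinkedIn⇒ShareEnd Ps unique (positionOf x) (positionOf y)
      (Equivalence.to (linkedIn⇔ x y) (complete (toℕ<n x) (toℕ<n y) (Adj-cross⁺ (xy , c≢)))))

  CLAdj⇒Adj : ∀ x y → CLAdj {H = H} φ (vertexEdge x) (vertexEdge y) → Adj G x y
  CLAdj⇒Adj x y (e≢ , inj₁ sh) = proj₁ (Adj-cross⁻ (sound (Equivalence.from (linkedIn⇔ x y)
    (ShareEnd⇒LinkedIn Ps unique (positionOf x) (positionOf y) (e≢ ∘ cong (edge Ps)) sh))))
  CLAdj⇒Adj x y (e≢ , inj₂ φ≡) =
    clique (bitOf-injective (trans (sym (φ-vertexEdge x)) (trans φ≡ (φ-vertexEdge y)))) (e≢ ∘ cong vertexEdge)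

  realisation : IsBipartitePathCycleCL G
  realisation = totalSize Ps , H , φ ,
    graph-bipartite colour Ps bichromatic-links , graph-components colour Ps bichromatic-links , proper ,
    ↔⇒⤖ vertexEdges , λ x y → mk⇔ (Adj⇒CLAdj x y) (CLAdj⇒Adj x y)

goodPartition⇒realisable : ∀ {n} (G : FinGraph n) → HasGoodCliquePartition G → IsBipartitePathCycleCL G
goodPartition⇒realisable {n} G (A , B , cover , disjoint , cliqueA , cliqueB , fewA , fewB) =
  LineGraphRealisation.realisation G colour clique degree≤2
  where
  colour : Fin n → Bool
  colour = Vec.lookup B

  part : Bool → Subset n
  part true = B
  part false = A

  ∈part : ∀ x → x ∈ₛ part (colour x)
  ∈part x with colour x in c≡
  ... | true = lookup⇒[]= x B c≡
  ... | false with cover x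
  ...   | inj₁ x∈A = x∈A
  ...   | inj₂ x∈B with () ← trans (sym c≡) ([]=⇒lookup x∈B)

  clique : ∀ {x y} → colour x ≡ colour y → x ≢ y → Adj G x y
  clique {x} {y} c≡ = partClique (colour x) x y (∈part x) (subst (λ b → y ∈ₛ part b) (sym c≡) (∈part y))
    where
    partClique : ∀ b → IsClique G (part b)
    partClique true = cliqueB
    partClique false = cliqueA

  degree≤2 : MaxDegree≤2 (CrossGraph.crossGraph G colour)
  degree≤2 x y₁ y₂ y₃ y₁≢y₂ y₁≢y₃ y₂≢y₃ (xy₁ , xy₂ , xy₃) =
    partFew (colour x) x (∈part x) y₁ y₂ y₃ (∈other xy₁) (∈other xy₂) (∈other xy₃)
      y₁≢y₂ y₁≢y₃ y₂≢y₃
      (proj₁ (Adj-cross⁻ xy₁) , proj₁ (Adj-cross⁻ xy₂) , proj₁ (Adj-cross⁻ xy₃))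
    where
    open CrossGraph G colour
    partFew : ∀ b x → x ∈ₛ part b → AtMostTwoNbrsIn G x (part (not b))
    partFew true = fewB
    partFew false = fewA
    ∈other : ∀ {y} → Adj crossGraph x y → y ∈ₛ part (not (colour x))
    ∈other {y} xy = subst (λ b → y ∈ₛ part b) (¬-not (≢-sym (proj₂ (Adj-cross⁻ xy)))) (∈part y)

module _ {m} {H : FinGraph m} (φ : EdgeColouring H) (proper : Proper {H = H} φ) where

  private
    Touches : Edge H → Fin m → Set
    Touches g w = src {H = H} g ≡ w ⊎ tgt {H = H} g ≡ w

    touched-end : ∀ e g → ShareEnd {H = H} e g → Touches g (src {H = H} e) ⊎ Touches g (tgt {H = H} e)
    touched-end e g (inj₁ p) = inj₁ (inj₁ (sym p))
    touched-end e g (inj₂ (inj₁ p)) = inj₁ (inj₂ (sym p))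
    touched-end e g (inj₂ (inj₂ (inj₁ p))) = inj₂ (inj₁ (sym p))
    touched-end e g (inj₂ (inj₂ (inj₂ p))) = inj₂ (inj₂ (sym p))

    touch-share : ∀ g h {w} → Touches g w → Touches h w → ShareEnd {H = H} g h
    touch-share g h (inj₁ p) (inj₁ q) = inj₁ (trans p (sym q))
    touch-share g h (inj₁ p) (inj₂ q) = inj₂ (inj₁ (trans p (sym q)))
    touch-share g h (inj₂ p) (inj₁ q) = inj₂ (inj₂ (inj₁ (trans p (sym q))))
    touch-share g h (inj₂ p) (inj₂ q) = inj₂ (inj₂ (inj₂ (trans p (sym q))))

  -- two of the three edges meet e at the same end
  no-three-same-colour-at : ∀ e g₁ g₂ g₃ → g₁ ≢ g₂ → g₁ ≢ g₃ → g₂ ≢ g₃ →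
    φ g₁ ≡ φ g₂ → φ g₁ ≡ φ g₃ →
    ShareEnd {H = H} e g₁ → ShareEnd {H = H} e g₂ → ShareEnd {H = H} e g₃ → ⊥
  no-three-same-colour-at e g₁ g₂ g₃ g₁≢g₂ g₁≢g₃ g₂≢g₃ c₁₂ c₁₃ s₁ s₂ s₃
    with touched-end e g₁ s₁ | touched-end e g₂ s₂ | touched-end e g₃ s₃
  ... | inj₁ t₁ | inj₁ t₂ | _ = proper g₁ g₂ g₁≢g₂ (touch-share g₁ g₂ t₁ t₂) c₁₂
  ... | inj₂ t₁ | inj₂ t₂ | _ = proper g₁ g₂ g₁≢g₂ (touch-share g₁ g₂ t₁ t₂) c₁₂
  ... | inj₁ t₁ | inj₂ _ | inj₁ t₃ = proper g₁ g₃ g₁≢g₃ (touch-share g₁ g₃ t₁ t₃) c₁₃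
  ... | inj₂ t₁ | inj₁ _ | inj₂ t₃ = proper g₁ g₃ g₁≢g₃ (touch-share g₁ g₃ t₁ t₃) c₁₃
  ... | inj₁ _ | inj₂ t₂ | inj₂ t₃ = proper g₂ g₃ g₂≢g₃ (touch-share g₂ g₃ t₂ t₃) (trans (sym c₁₂) c₁₃)
  ... | inj₂ _ | inj₁ t₂ | inj₁ t₃ = proper g₂ g₃ g₂≢g₃ (touch-share g₂ g₃ t₂ t₃) (trans (sym c₁₂) c₁₃)

module ColourClasses {n m} (G : FinGraph n) (H : FinGraph m) (φ : EdgeColouring H)
  (proper : Proper {H = H} φ) (iso : IsoCL G H φ) where

  private
    edgeOf : Fin n → Edge H
    edgeOf = Bijection.to (proj₁ iso)

  colour : Fin n → Fin 2
  colour x = φ (edgeOf x)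

  class : Fin 2 → Subset n
  class k = Vec.tabulate (λ x → isYes (colour x Fin.≟ k))

  ∈class⁻ : ∀ {k x} → x ∈ₛ class k → colour x ≡ k
  ∈class⁻ {k} {x} x∈ = isYes⇒ (colour x Fin.≟ k) (trans (sym (lookup∘tabulate _ x)) ([]=⇒lookup x∈))

  ∈class⁺ : ∀ {k x} → colour x ≡ k → x ∈ₛ class k
  ∈class⁺ {k} {x} c≡ = lookup⇒[]= x (class k) (trans (lookup∘tabulate _ x) (⇒isYes (colour x Fin.≟ k) c≡))

  cover : ∀ x → x ∈ₛ class fzero ⊎ x ∈ₛ class (fsuc fzero)
  cover x with colour x in c≡
  ... | fzero = inj₁ (∈class⁺ c≡)
  ... | fsuc fzero = inj₂ (∈class⁺ c≡)

  disjoint : ∀ x → ¬ (x ∈ₛ class fzero × x ∈ₛ class (fsuc fzero))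
  disjoint x (x∈₀ , x∈₁) with () ← trans (sym (∈class⁻ x∈₀)) (∈class⁻ x∈₁)

  edgeOf-distinct : ∀ {x y} → x ≢ y → edgeOf x ≢ edgeOf y
  edgeOf-distinct x≢y eq = x≢y (Bijection.injective (proj₁ iso) eq)

  class-clique : ∀ k → IsClique G (class k)
  class-clique k x y x∈ y∈ x≢y =
    Equivalence.from (proj₂ iso x y) (edgeOf-distinct x≢y , inj₂ (trans (∈class⁻ x∈) (sym (∈class⁻ y∈))))

  -- a neighbour of the other colour corresponds to an edge sharing an end
  few-across : ∀ k k′ → k ≢ k′ → ∀ x → x ∈ₛ class k → AtMostTwoNbrsIn G x (class k′)
  few-across k k′ k≢k′ x x∈ y₁ y₂ y₃ y₁∈ y₂∈ y₃∈ y₁≢y₂ y₁≢y₃ y₂≢y₃ (xy₁ , xy₂ , xy₃) =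
    no-three-same-colour-at {H = H} φ proper (edgeOf x) _ _ _
      (edgeOf-distinct y₁≢y₂) (edgeOf-distinct y₁≢y₃) (edgeOf-distinct y₂≢y₃)
      (trans (∈class⁻ y₁∈) (sym (∈class⁻ y₂∈))) (trans (∈class⁻ y₁∈) (sym (∈class⁻ y₃∈)))
      (share xy₁ y₁∈) (share xy₂ y₂∈) (share xy₃ y₃∈)
    where
    share : ∀ {y} → Adj G x y → y ∈ₛ class k′ → ShareEnd {H = H} (edgeOf x) (edgeOf y)
    share {y} xy y∈ with Equivalence.to (proj₂ iso x y) xy
    ... | _ , inj₁ sh = sh
    ... | _ , inj₂ φ≡ = ⊥-elim (k≢k′ (trans (sym (∈class⁻ x∈)) (trans φ≡ (∈class⁻ y∈))))

  goodPartition : HasGoodCliquePartition G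
  goodPartition = class fzero , class (fsuc fzero) , cover , disjoint ,
    class-clique fzero , class-clique (fsuc fzero) ,
    few-across fzero (fsuc fzero) (λ ()) , few-across (fsuc fzero) fzero (λ ())

colourLine⇒goodPartition : ∀ {n} (G : FinGraph n) → IsProper2ColourLine G → HasGoodCliquePartition G
colourLine⇒goodPartition G (_ , H , φ , proper , iso) = ColourClasses.goodPartition G H φ proper iso

proposition2 : ∀ {n : ℕ} (G : FinGraph n) →
    (IsProper2ColourLine G ⇔ HasGoodCliquePartition G) ×
    (HasGoodCliquePartition G ⇔ IsBipartitePathCycleCL G)
proposition2 G =
  mk⇔ (colourLine⇒goodPartition G) (forget ∘ goodPartition⇒realisable G) ,
  mk⇔ (goodPartition⇒realisable G) (colourLine⇒goodPartition G ∘ forget)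
  where
  forget : IsBipartitePathCycleCL G → IsProper2ColourLine G
  forget (m , H , φ , _ , _ , proper , iso) = m , H , φ , proper , iso
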